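{- Let $n\ge2$ and $N\ge1$. Every double coset $\Gamma_0^n(N)\,g\,P_{n,n-1}(\mathbf Q)$ with $g\in\mathrm{Sp}_n(\mathbf Q)$ contains an element of the set $P_{n,n-1}(\mathbf Q)R$; that is, representatives of $\Gamma^n_0(N)\backslash\mathrm{Sp}_n(\mathbf Q)/P_{n,n-1}(\mathbf Q)$ can be chosen from $P_{n,n-1}(\mathbf Q)R$.
   Context: $\Gamma_0^n(N)=\{\begin{pmatrix}A&B\\C&D\end{pmatrix}\in\mathrm{Sp}_n(\mathbf Z): C\equiv0\bmod N\}$. For $1\le r\le n-1$ and a subring $R_0\subseteq\mathbf R$, $P_{n,r}(R_0)$ is the set of matrices in $\mathrm{Sp}_n(R_0)$ of the block form $\begin{pmatrix} a_{11}&0&b_{11}&b_{12}\\ a_{21}&a_{22}&b_{21}&b_{22}\\ c_{11}&0&d_{11}&d_{12}\\ 0&0&0&d_{22}\end{pmatrix}$, where blocks with index $11$ are $r\times r$ and those with index $22$ are $(n-r)\times(n-r)$ (here $r=n-1$). $R=\begin{pmatrix}M_0&0\\0&M_0\end{pmatrix}$, where $M_0$ is the $n\times n$ matrix with $1$'s on the anti-diagonal and $0$'s elsewhere. -}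

module Defs where

open import Data.Nat as ℕ using (ℕ; zero; suc; _∸_)
open import Data.Integer as ℤ using (ℤ; +_)
open import Data.Rational using (ℚ; 0ℚ; 1ℚ; _+_; _*_; -_; _/_)
open import Data.Fin using (Fin; toℕ; splitAt; _↑ˡ_; _↑ʳ_)
open import Data.Fin as F using ()
open import Data.Sum using (inj₁; inj₂)
open import Data.Product using (∃; _×_)
open import Relation.Binary.PropositionalEquality using (_≡_; _≢_)
open import Relation.Nullary using (yes; no)

Mat : ℕ → Set
Mat m = Fin m → Fin m → ℚ

sumℚ : ∀ {m} → (Fin m → ℚ) → ℚ
sumℚ {zero}  f = 0ℚ
sumℚ {suc m} f = f F.zero + sumℚ (λ k → f (F.suc k))

infixl 7 _⊗_
_⊗_ : ∀ {m} → Mat m → Mat m → Mat m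
(A ⊗ B) i j = sumℚ (λ k → A i k * B k j)

transpose : ∀ {m} → Mat m → Mat m
transpose A i j = A j i

infix 4 _≈M_
_≈M_ : ∀ {m} → Mat m → Mat m → Set
A ≈M B = ∀ i j → A i j ≡ B i j

δ : ∀ {n} → Fin n → Fin n → ℚ
δ i j with i F.≟ j
... | yes _ = 1ℚ
... | no  _ = 0ℚ

top : ∀ {n} → Fin n → Fin (n ℕ.+ n)
top {n} i = i ↑ˡ n

bot : ∀ {n} → Fin n → Fin (n ℕ.+ n)
bot {n} i = n ↑ʳ i

-- J = ( 0  1 ; -1  0 )
J : (n : ℕ) → Mat (n ℕ.+ n)
J n x y with splitAt n x | splitAt n y
... | inj₁ i | inj₂ j = δ i j
... | inj₂ i | inj₁ j = - δ i j
... | _      | _      = 0ℚ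

IsSp : (n : ℕ) → Mat (n ℕ.+ n) → Set
IsSp n M = transpose M ⊗ J n ⊗ M ≈M J n

IsInt : ℚ → Set
IsInt q = ∃ λ (z : ℤ) → q ≡ z / 1

InΓ₀ : (n N : ℕ) → Mat (n ℕ.+ n) → Set
InΓ₀ n N M = IsSp n M × (∀ x y → IsInt (M x y))
  × (∀ (i j : Fin n) → ∃ λ (z : ℤ) → M (bot i) (top j) ≡ ((+ N) ℤ.* z) / 1)

-- P_{n,n-1}(Q); "last" index is the one with toℕ = n ∸ 1 (the 22-block, size 1)
IsLast : ∀ {n} → Fin n → Set
IsLast {n} i = toℕ i ≡ n ∸ 1

InP : (n : ℕ) → Mat (n ℕ.+ n) → Set
InP n M = IsSp n M
  -- a12 = 0
  × (∀ (i j : Fin n) → ¬L i → IsLast j → M (top i) (top j) ≡ 0ℚ)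
  -- c12 = 0
  × (∀ (i j : Fin n) → ¬L i → IsLast j → M (bot i) (top j) ≡ 0ℚ)
  -- c21 = 0, c22 = 0 (last bottom row, left half)
  × (∀ (i j : Fin n) → IsLast i → M (bot i) (top j) ≡ 0ℚ)
  -- d21 = 0
  × (∀ (i j : Fin n) → IsLast i → ¬L j → M (bot i) (bot j) ≡ 0ℚ)
  where
  ¬L : Fin n → Set
  ¬L i = toℕ i ≢ n ∸ 1

M0 : (n : ℕ) → Fin n → Fin n → ℚ
M0 n i j with toℕ i ℕ.+ toℕ j ℕ.≟ n ∸ 1
... | yes _ = 1ℚ
... | no  _ = 0ℚ

R : (n : ℕ) → Mat (n ℕ.+ n)
R n x y with splitAt n x | splitAt n y
... | inj₁ i | inj₁ j = M0 n i j
... | inj₂ i | inj₂ j = M0 n i j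
... | _      | _      = 0ℚ

-- Indices are 0-based. Let ℓ = n - 1 and a = z = 0, so that R swaps e_z and e_ℓ, and let w = g e_ℓ.
-- Pick integers with s y - x t = 1 and x w_{n+a} + y w_{n+ℓ} = 0, taking (x, y) off the line of
-- (w_a, w_ℓ) when both of these vanish. Placing (y -x; -t s) ∈ SL₂(ℤ) at the coordinates a, ℓ gives
-- γ = diag(A, A⁻ᵀ) ∈ Γ₀(N) with γ v = e_ℓ for v = x e_a + y e_ℓ. Since g preserves the non-degenerate
-- form ω it is onto; take u with g u = v. Then u_{n+ℓ} = ω(e_ℓ, u) = ω(w, v) = 0, and u is not a
-- multiple of e_ℓ. Symplectic transvections along vectors with vanishing (n+ℓ)-th entry fix e_ℓ, hence
-- lie in P, and at most two of them carry e_z to u; let p be their product. Then X = γ g p maps e_z to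
-- e_ℓ, so q = X R is symplectic and fixes e_ℓ, which puts it in P, and γ g p = X = q R.

module Submission where

open import Defs
open import Data.Nat using (ℕ; _≤_)
open import Data.Product using (∃; _×_)
import Data.Nat as ℕ
import Data.Nat.Properties as ℕP
open import Data.Nat using (zero; suc; s≤s; z≤n)
open import Data.Nat.Coprimality as Coprimality using (Coprime; coprime-Bézout; 1-coprimeTo; recompute)
open import Data.Nat.GCD using (module Bézout)
open import Data.Integer as ℤ using (ℤ; +_; -[1+_]; 1ℤ)
import Data.Integer.Properties as ℤP
import Data.Integer.Tactic.RingSolver as ℤ-Solver
open import Data.Rational as Q using (ℚ; 0ℚ; 1ℚ; _+_; _*_; -_; _-_; 1/_; _/_; mkℚ)
import Data.Rational.Properties as QP
import Data.Rational.Unnormalised as QU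
import Data.Rational.Unnormalised.Properties as QUP
open import Data.Fin as F using (Fin; toℕ; splitAt; opposite; punchIn; _↑ˡ_; _↑ʳ_)
import Data.Fin.Properties as FP
open import Data.Vec.Functional using (Vector; _∷_)
open import Data.Sum using (_⊎_; inj₁; inj₂)
open import Data.Product using (_,_; proj₁; proj₂; ∃₂)
open import Data.Empty using (⊥; ⊥-elim)
open import Function using (_∘_; case_of_)
open import Level using (0ℓ)
open import Algebra.Bundles using (Ring)
open import Algebra.Properties.Group QP.+-0-group using () renaming (⁻¹-involutive to neg-involutive)
open import Algebra.Properties.Semiring.Sum (Ring.semiring QP.+-*-ring)
  using (sum; ∑-distrib-+; ∑-comm; *-distribˡ-sum; *-distribʳ-sum; sum-replicate-zero)
open import Relation.Binary.PropositionalEquality hiding (J)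
open import Relation.Nullary using (yes; no; ¬?; Dec)
open import Relation.Nullary.Decidable using (dec⇒maybe; decidable-stable; _×-dec_)
open import Tactic.RingSolver using (solve-∀)
open import Tactic.RingSolver.Core.AlmostCommutativeRing using (AlmostCommutativeRing; fromCommutativeRing)

ℚ-ring : AlmostCommutativeRing 0ℓ 0ℓ
ℚ-ring = fromCommutativeRing QP.+-*-commutativeRing (λ x → dec⇒maybe (0ℚ QP.≟ x))

sumℚ≡sum : ∀ {m} (f : Vector ℚ m) → sumℚ f ≡ sum f
sumℚ≡sum {zero}  f = refl
sumℚ≡sum {suc m} f = cong (λ s → f F.zero + s) (sumℚ≡sum (f ∘ F.suc))

sumℚ-cong : ∀ {m} {f g : Vector ℚ m} → (∀ k → f k ≡ g k) → sumℚ f ≡ sumℚ g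
sumℚ-cong {zero}  f≗g = refl
sumℚ-cong {suc m} f≗g = cong₂ _+_ (f≗g F.zero) (sumℚ-cong (f≗g ∘ F.suc))

sumℚ-zero : ∀ {m} {f : Vector ℚ m} → (∀ k → f k ≡ 0ℚ) → sumℚ f ≡ 0ℚ
sumℚ-zero {m} f≗0 = trans (sumℚ-cong f≗0) (trans (sumℚ≡sum {m} (λ _ → 0ℚ)) (sum-replicate-zero m))

sumℚ-distrib-+ : ∀ {m} (f g : Vector ℚ m) → sumℚ (λ k → f k + g k) ≡ sumℚ f + sumℚ g
sumℚ-distrib-+ f g = begin
  sumℚ (λ k → f k + g k)  ≡⟨ sumℚ≡sum (λ k → f k + g k) ⟩
  sum (λ k → f k + g k)   ≡⟨ ∑-distrib-+ f g ⟩
  sum f + sum g           ≡⟨ cong₂ _+_ (sumℚ≡sum f) (sumℚ≡sum g) ⟨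
  sumℚ f + sumℚ g         ∎
  where open ≡-Reasoning

sumℚ-comm : ∀ {m m′} (f : Fin m → Fin m′ → ℚ) →
  sumℚ (λ i → sumℚ (f i)) ≡ sumℚ (λ j → sumℚ (λ i → f i j))
sumℚ-comm f = begin
  sumℚ (λ i → sumℚ (f i))            ≡⟨ sumℚ-cong (λ i → sumℚ≡sum (f i)) ⟩
  sumℚ (λ i → sum (f i))             ≡⟨ sumℚ≡sum (λ i → sum (f i)) ⟩
  sum (λ i → sum (f i))              ≡⟨ ∑-comm f ⟩
  sum (λ j → sum (λ i → f i j))      ≡⟨ sumℚ≡sum (λ j → sum (λ i → f i j)) ⟨
  sumℚ (λ j → sum (λ i → f i j))     ≡⟨ sumℚ-cong (λ j → sumℚ≡sum (λ i → f i j)) ⟨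
  sumℚ (λ j → sumℚ (λ i → f i j))    ∎
  where open ≡-Reasoning

*-distribˡ-sumℚ : ∀ {m} c (f : Vector ℚ m) → c * sumℚ f ≡ sumℚ (λ k → c * f k)
*-distribˡ-sumℚ c f = begin
  c * sumℚ f             ≡⟨ cong (c *_) (sumℚ≡sum f) ⟩
  c * sum f              ≡⟨ *-distribˡ-sum c f ⟩
  sum (λ k → c * f k)    ≡⟨ sumℚ≡sum (λ k → c * f k) ⟨
  sumℚ (λ k → c * f k)   ∎
  where open ≡-Reasoning

*-distribʳ-sumℚ : ∀ {m} c (f : Vector ℚ m) → sumℚ f * c ≡ sumℚ (λ k → f k * c)
*-distribʳ-sumℚ c f = begin
  sumℚ f * c             ≡⟨ cong (_* c) (sumℚ≡sum f) ⟩
  sum f * c              ≡⟨ *-distribʳ-sum c f ⟩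
  sum (λ k → f k * c)    ≡⟨ sumℚ≡sum (λ k → f k * c) ⟨
  sumℚ (λ k → f k * c)   ∎
  where open ≡-Reasoning

neg-distrib-sumℚ : ∀ {m} (f : Vector ℚ m) → - sumℚ f ≡ sumℚ (λ k → - f k)
neg-distrib-sumℚ {zero}  f = refl
neg-distrib-sumℚ {suc m} f =
  trans (QP.neg-distrib-+ (f F.zero) _) (cong (λ s → - f F.zero + s) (neg-distrib-sumℚ (f ∘ F.suc)))

sumℚ-linear : ∀ {m} α β (f g : Vector ℚ m) →
  sumℚ (λ k → α * f k + β * g k) ≡ α * sumℚ f + β * sumℚ g
sumℚ-linear α β f g = begin
  sumℚ (λ k → α * f k + β * g k)            ≡⟨ sumℚ-distrib-+ (λ k → α * f k) (λ k → β * g k) ⟩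
  sumℚ (λ k → α * f k) + sumℚ (λ k → β * g k) ≡⟨ cong₂ _+_ (*-distribˡ-sumℚ α f) (*-distribˡ-sumℚ β g) ⟨
  α * sumℚ f + β * sumℚ g                   ∎
  where open ≡-Reasoning

sumℚ-splitAt : ∀ a b (f : Vector ℚ (a ℕ.+ b)) →
  sumℚ f ≡ sumℚ (λ i → f (i ↑ˡ b)) + sumℚ (λ i → f (a ↑ʳ i))
sumℚ-splitAt zero    b f = sym (QP.+-identityˡ (sumℚ f))
sumℚ-splitAt (suc a) b f =
  trans (cong (λ s → f F.zero + s) (sumℚ-splitAt a b (f ∘ F.suc))) (sym (QP.+-assoc (f F.zero) _ _))

sumℚ-single : ∀ {m} (j : Fin m) (f : Vector ℚ m) → (∀ k → k ≢ j → f k ≡ 0ℚ) → sumℚ f ≡ f j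
sumℚ-single {suc m} F.zero    f off = begin
  f F.zero + sumℚ (f ∘ F.suc) ≡⟨ cong (λ s → f F.zero + s) (sumℚ-zero (λ k → off (F.suc k) λ ())) ⟩
  f F.zero + 0ℚ               ≡⟨ QP.+-identityʳ (f F.zero) ⟩
  f F.zero                    ∎
  where open ≡-Reasoning
sumℚ-single {suc m} (F.suc j) f off = begin
  f F.zero + sumℚ (f ∘ F.suc)
    ≡⟨ cong₂ _+_ (off F.zero λ ()) (sumℚ-single j (f ∘ F.suc) λ k k≢j → off (F.suc k) (k≢j ∘ FP.suc-injective)) ⟩
  0ℚ + f (F.suc j)
    ≡⟨ QP.+-identityˡ (f (F.suc j)) ⟩
  f (F.suc j) ∎
  where open ≡-Reasoning

δ-refl : ∀ {m} (i : Fin m) → δ i i ≡ 1ℚ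
δ-refl i with i F.≟ i
... | yes _   = refl
... | no i≢i  = ⊥-elim (i≢i refl)

δ-≢ : ∀ {m} {i j : Fin m} → i ≢ j → δ i j ≡ 0ℚ
δ-≢ {i = i} {j} i≢j with i F.≟ j
... | yes i≡j = ⊥-elim (i≢j i≡j)
... | no _    = refl

δ-sym : ∀ {m} (i j : Fin m) → δ i j ≡ δ j i
δ-sym i j with i F.≟ j
... | yes refl = sym (δ-refl i)
... | no i≢j   = sym (δ-≢ (i≢j ∘ sym))

δ-injective : ∀ {m m′} {f : Fin m → Fin m′} → (∀ {i j} → f i ≡ f j → i ≡ j) →
  ∀ i j → δ (f i) (f j) ≡ δ i j
δ-injective {f = f} f-inj i j with i F.≟ j
... | yes refl = δ-refl (f i)
... | no i≢j   = δ-≢ (i≢j ∘ f-inj)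

sumℚ-δˡ : ∀ {m} (j : Fin m) (f : Vector ℚ m) → sumℚ (λ k → δ k j * f k) ≡ f j
sumℚ-δˡ j f = begin
  sumℚ (λ k → δ k j * f k) ≡⟨ sumℚ-single j _ (λ k k≢j → trans (cong (_* f k) (δ-≢ k≢j)) (QP.*-zeroˡ (f k))) ⟩
  δ j j * f j              ≡⟨ cong (_* f j) (δ-refl j) ⟩
  1ℚ * f j                 ≡⟨ QP.*-identityˡ (f j) ⟩
  f j                      ∎
  where open ≡-Reasoning

sumℚ-δʳ : ∀ {m} (j : Fin m) (f : Vector ℚ m) → sumℚ (λ k → f k * δ k j) ≡ f j
sumℚ-δʳ j f = trans (sumℚ-cong (λ k → QP.*-comm (f k) (δ k j))) (sumℚ-δˡ j f)

sumℚ-pair : ∀ {m} α β (a b : Fin m) (f : Vector ℚ m) →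
  sumℚ (λ k → (α * δ k a + β * δ k b) * f k) ≡ α * f a + β * f b
sumℚ-pair α β a b f = begin
  sumℚ (λ k → (α * δ k a + β * δ k b) * f k)
    ≡⟨ sumℚ-cong (λ k → distrib α β (δ k a) (δ k b) (f k)) ⟩
  sumℚ (λ k → α * (δ k a * f k) + β * (δ k b * f k))
    ≡⟨ sumℚ-linear α β (λ k → δ k a * f k) (λ k → δ k b * f k) ⟩
  α * sumℚ (λ k → δ k a * f k) + β * sumℚ (λ k → δ k b * f k)
    ≡⟨ cong₂ (λ p q → α * p + β * q) (sumℚ-δˡ a f) (sumℚ-δˡ b f) ⟩
  α * f a + β * f b ∎
  where
  open ≡-Reasoning
  distrib : ∀ α β p q x → (α * p + β * q) * x ≡ α * (p * x) + β * (q * x)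
  distrib = solve-∀ ℚ-ring

unit : ∀ {m} → Fin m → Vector ℚ m
unit j i = δ i j

infixr 7 _·_

_·_ : ∀ {m} → Mat m → Vector ℚ m → Vector ℚ m
(A · x) i = sumℚ (λ k → A i k * x k)

·-congʳ : ∀ {m} (A : Mat m) {x y : Vector ℚ m} → (∀ k → x k ≡ y k) → ∀ i → (A · x) i ≡ (A · y) i
·-congʳ A x≗y i = sumℚ-cong (λ k → cong (A i k *_) (x≗y k))

·-unit : ∀ {m} (A : Mat m) j i → (A · unit j) i ≡ A i j
·-unit A j i = sumℚ-δʳ j (A i)

δ-· : ∀ {m} (x : Vector ℚ m) i → (δ · x) i ≡ x i
δ-· x i = trans (sumℚ-cong (λ k → cong (_* x k) (δ-sym i k))) (sumℚ-δˡ i x)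

·-assoc : ∀ {m} (A B : Mat m) x i → ((A ⊗ B) · x) i ≡ (A · (B · x)) i
·-assoc A B x i = begin
  sumℚ (λ k → sumℚ (λ l → A i l * B l k) * x k) ≡⟨ sumℚ-cong (λ k → *-distribʳ-sumℚ (x k) (λ l → A i l * B l k)) ⟩
  sumℚ (λ k → sumℚ (λ l → A i l * B l k * x k)) ≡⟨ sumℚ-comm (λ k l → A i l * B l k * x k) ⟩
  sumℚ (λ l → sumℚ (λ k → A i l * B l k * x k)) ≡⟨ sumℚ-cong (λ l → sumℚ-cong (λ k → QP.*-assoc (A i l) (B l k) (x k))) ⟩
  sumℚ (λ l → sumℚ (λ k → A i l * (B l k * x k))) ≡⟨ sumℚ-cong (λ l → *-distribˡ-sumℚ (A i l) (λ k → B l k * x k)) ⟨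
  sumℚ (λ l → A i l * sumℚ (λ k → B l k * x k)) ∎
  where open ≡-Reasoning

Singular : ∀ {m} → Mat m → Set
Singular {m} A = ∃ λ (x : Vector ℚ m) → (∀ i → (A · x) i ≡ 0ℚ) × ∃ λ i → x i ≢ 0ℚ

Surjective : ∀ {m} → Mat m → Set
Surjective {m} A = ∀ (b : Vector ℚ m) → ∃ λ (x : Vector ℚ m) → ∀ i → (A · x) i ≡ b i

module Elimination {m} (A : Mat (suc m)) (r : Fin (suc m)) (pivot≢0 : A r F.zero ≢ 0ℚ) where
  private
    shift-solution : ∀ f br sr si bi → si - f * sr ≡ bi - f * br → f * (br - sr) + si ≡ bi
    shift-solution f br sr si bi eq = begin
      f * (br - sr) + si      ≡⟨ expand f br sr si ⟩
      (si - f * sr) + f * br  ≡⟨ cong (_+ f * br) eq ⟩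
      (bi - f * br) + f * br  ≡⟨ cancel bi (f * br) ⟩
      bi                      ∎
      where
      open ≡-Reasoning
      expand : ∀ f br sr si → f * (br - sr) + si ≡ (si - f * sr) + f * br
      expand = solve-∀ ℚ-ring
      cancel : ∀ a b → (a - b) + b ≡ a
      cancel = solve-∀ ℚ-ring

    x-1x≡0 : ∀ x → x - 1ℚ * x ≡ 0ℚ
    x-1x≡0 = solve-∀ ℚ-ring

    0-x0≡0 : ∀ x → 0ℚ - x * 0ℚ ≡ 0ℚ
    0-x0≡0 = solve-∀ ℚ-ring

  pivot⁻¹ : ℚ
  pivot⁻¹ = (1/ A r F.zero) {{Q.≢-nonZero pivot≢0}}

  factor : Vector ℚ (suc m)
  factor i = A i F.zero * pivot⁻¹

  reduced : Mat m
  reduced i j = A (punchIn r i) (F.suc j) - factor (punchIn r i) * A r (F.suc j)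

  tailSum : Vector ℚ m → Vector ℚ (suc m)
  tailSum x i = sumℚ (λ j → A i (F.suc j) * x j)

  reduced-· : ∀ (x : Vector ℚ m) i → (reduced · x) i ≡ tailSum x (punchIn r i) - factor (punchIn r i) * tailSum x r
  reduced-· x i = begin
    sumℚ (λ j → (a j - f * c j) * x j)                ≡⟨ sumℚ-cong (λ j → expand (a j) f (c j) (x j)) ⟩
    sumℚ (λ j → 1ℚ * (a j * x j) + - f * (c j * x j)) ≡⟨ sumℚ-linear 1ℚ (- f) (λ j → a j * x j) (λ j → c j * x j) ⟩
    1ℚ * tailSum x i′ + - f * tailSum x r             ≡⟨ collect (tailSum x i′) f (tailSum x r) ⟩
    tailSum x i′ - f * tailSum x r                    ∎
    where
    open ≡-Reasoning
    i′ = punchIn r i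
    f = factor i′
    a c : Vector ℚ m
    a j = A i′ (F.suc j)
    c j = A r (F.suc j)
    expand : ∀ a f c x → (a - f * c) * x ≡ 1ℚ * (a * x) + - f * (c * x)
    expand = solve-∀ ℚ-ring
    collect : ∀ s f t → 1ℚ * s + - f * t ≡ s - f * t
    collect = solve-∀ ℚ-ring

  back-substitute : Vector ℚ (suc m) → Vector ℚ m → Vector ℚ (suc m)
  back-substitute b x = pivot⁻¹ * (b r - tailSum x r) ∷ x

  lift-solution : ∀ (b : Vector ℚ (suc m)) (x : Vector ℚ m) →
    (∀ i → (reduced · x) i ≡ b (punchIn r i) - factor (punchIn r i) * b r) →
    ∀ i → (A · back-substitute b x) i ≡ b i
  lift-solution b x reduced-solves i = begin
    A i F.zero * (pivot⁻¹ * (b r - tailSum x r)) + tailSum x i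
      ≡⟨ cong (_+ tailSum x i) (sym (QP.*-assoc (A i F.zero) pivot⁻¹ (b r - tailSum x r))) ⟩
    factor i * (b r - tailSum x r) + tailSum x i
      ≡⟨ shift-solution (factor i) (b r) (tailSum x r) (tailSum x i) (b i) (eliminated i) ⟩
    b i ∎
    where
    open ≡-Reasoning
    factor-r : factor r ≡ 1ℚ
    factor-r = QP.*-inverseʳ (A r F.zero) {{Q.≢-nonZero pivot≢0}}
    eliminated : ∀ i → tailSum x i - factor i * tailSum x r ≡ b i - factor i * b r
    eliminated i with r F.≟ i
    ... | yes refl = trans (self-eliminated (tailSum x r)) (sym (self-eliminated (b r)))
      where
      self-eliminated : ∀ y → y - factor r * y ≡ 0ℚ
      self-eliminated y = trans (cong (λ f → y - f * y) factor-r) (x-1x≡0 y)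
    ... | no r≢i = subst (λ i → tailSum x i - factor i * tailSum x r ≡ b i - factor i * b r)
                         (FP.punchIn-punchOut r≢i)
                         (trans (sym (reduced-· x (F.punchOut r≢i))) (reduced-solves (F.punchOut r≢i)))

  lift : Singular reduced ⊎ Surjective reduced → Singular A ⊎ Surjective A
  lift (inj₁ (x , reduced-x≡0 , i , xᵢ≢0)) =
    inj₁ (back-substitute (λ _ → 0ℚ) x ,
          lift-solution (λ _ → 0ℚ) x (λ i → trans (reduced-x≡0 i) (sym (0-x0≡0 (factor (punchIn r i))))) ,
          F.suc i , xᵢ≢0)
  lift (inj₂ reduced-onto) = inj₂ λ b →
    let x , x-solves = reduced-onto (λ i → b (punchIn r i) - factor (punchIn r i) * b r)
    in back-substitute b x , lift-solution b x x-solves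

singular⊎surjective : ∀ {m} (A : Mat m) → Singular A ⊎ Surjective A
singular⊎surjective {zero}  A = inj₂ λ b → (λ ()) , λ ()
singular⊎surjective {suc m} A with FP.any? (λ r → ¬? (A r F.zero QP.≟ 0ℚ))
... | yes (r , pivot≢0) = Elimination.lift A r pivot≢0 (singular⊎surjective (Elimination.reduced A r pivot≢0))
... | no no-pivot = inj₁ (unit F.zero , first-column≡0 , F.zero , λ ())
  where
  first-column≡0 : ∀ i → (A · unit F.zero) i ≡ 0ℚ
  first-column≡0 i = trans (·-unit A F.zero i) (decidable-stable (A i F.zero QP.≟ 0ℚ) λ ≢0 → no-pivot (i , ≢0))

ι : ℤ → ℚ
ι z = z / 1

private
  normalised : ℤ → ℚ
  normalised z = mkℚ z 0 (Coprimality.sym (1-coprimeTo ℤ.∣ z ∣))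

  ι≡normalised : ∀ z → ι z ≡ normalised z
  ι≡normalised z = QP.↥p/↧p≡p (normalised z)

ι-homo-+ : ∀ a b → ι (a ℤ.+ b) ≡ ι a + ι b
ι-homo-+ a b = sym (trans (cong₂ _+_ (ι≡normalised a) (ι≡normalised b))
                          (cong (_/ 1) (cong₂ ℤ._+_ (ℤP.*-identityʳ a) (ℤP.*-identityʳ b))))

ι-homo-* : ∀ a b → ι (a ℤ.* b) ≡ ι a * ι b
ι-homo-* a b = sym (cong₂ _*_ (ι≡normalised a) (ι≡normalised b))

ι-homo-neg : ∀ a → ι (ℤ.- a) ≡ - ι a
ι-homo-neg a = trans (ι≡normalised (ℤ.- a)) (trans (neg-normalised a) (cong -_ (sym (ι≡normalised a))))
  where
  neg-normalised : ∀ a → normalised (ℤ.- a) ≡ - normalised a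
  neg-normalised (+ zero)  = refl
  neg-normalised (+ suc n) = refl
  neg-normalised -[1+ n ]  = refl

ι-homo-det : ∀ s y x t → ι (s ℤ.* y ℤ.- x ℤ.* t) ≡ ι s * ι y - ι x * ι t
ι-homo-det s y x t = begin
  ι (s ℤ.* y ℤ.- x ℤ.* t)        ≡⟨ ι-homo-+ (s ℤ.* y) (ℤ.- (x ℤ.* t)) ⟩
  ι (s ℤ.* y) + ι (ℤ.- (x ℤ.* t)) ≡⟨ cong₂ _+_ (ι-homo-* s y) (trans (ι-homo-neg (x ℤ.* t)) (cong -_ (ι-homo-* x t))) ⟩
  ι s * ι y - ι x * ι t          ∎
  where open ≡-Reasoning

IsInt-ι : ∀ z → IsInt (ι z)
IsInt-ι z = z , refl

IsInt-+ : ∀ {a b} → IsInt a → IsInt b → IsInt (a + b)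
IsInt-+ (za , refl) (zb , refl) = za ℤ.+ zb , sym (ι-homo-+ za zb)

IsInt-* : ∀ {a b} → IsInt a → IsInt b → IsInt (a * b)
IsInt-* (za , refl) (zb , refl) = za ℤ.* zb , sym (ι-homo-* za zb)

IsInt-neg : ∀ {a} → IsInt a → IsInt (- a)
IsInt-neg (za , refl) = ℤ.- za , sym (ι-homo-neg za)

IsInt-δ : ∀ {m} (i j : Fin m) → IsInt (δ i j)
IsInt-δ i j with i F.≟ j
... | yes _ = 1ℤ , refl
... | no _  = + 0 , refl

denominator*≡numerator : ∀ r → ι (Q.ℚ.denominator r) * r ≡ ι (Q.ℚ.numerator r)
denominator*≡numerator r@(mkℚ a d _) = begin
  ι (+ suc d) * r   ≡⟨ cong (_* r) (ι≡normalised (+ suc d)) ⟩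
  normalised (+ suc d) * r ≡⟨ QP.toℚᵘ-injective (QUP.≃-trans (QP.toℚᵘ-homo-* (normalised (+ suc d)) r) (QU.*≡* cross)) ⟩
  normalised a      ≡⟨ ι≡normalised a ⟨
  ι a               ∎
  where
  open ≡-Reasoning
  cross : (+ suc d ℤ.* a) ℤ.* + 1 ≡ a ℤ.* + suc (d ℕ.+ 0)
  cross = trans (ℤP.*-identityʳ _) (trans (ℤP.*-comm (+ suc d) a) (cong (λ k → a ℤ.* + suc k) (sym (ℕP.+-identityʳ d))))

private
  ℕ-identity-in-ℤ : ∀ a b c d → 1 ℕ.+ a ℕ.* b ≡ c ℕ.* d → 1ℤ ℤ.+ (+ a) ℤ.* (+ b) ≡ (+ c) ℤ.* (+ d)
  ℕ-identity-in-ℤ a b c d eq = begin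
    1ℤ ℤ.+ (+ a) ℤ.* (+ b)  ≡⟨ cong (λ z → 1ℤ ℤ.+ z) (ℤP.pos-* a b) ⟨
    1ℤ ℤ.+ + (a ℕ.* b)  ≡⟨ ℤP.pos-+ 1 (a ℕ.* b) ⟨
    + (1 ℕ.+ a ℕ.* b)   ≡⟨ cong +_ eq ⟩
    + (c ℕ.* d)         ≡⟨ ℤP.pos-* c d ⟩
    + c ℤ.* (+ d)         ∎
    where open ≡-Reasoning

bézout : ∀ (a : ℤ) (X : ℕ) → Coprime ℤ.∣ a ∣ X → ∃₂ λ s t → s ℤ.* a ℤ.- (+ X) ℤ.* t ≡ 1ℤ
bézout (+ m) X coprime with coprime-Bézout coprime
... | Bézout.+- x y eq = + x , + y , identity
  where
  open ≡-Reasoning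
  cancel : ∀ y X → 1ℤ ℤ.+ y ℤ.* X ℤ.- X ℤ.* y ≡ 1ℤ
  cancel = ℤ-Solver.solve-∀
  identity : (+ x) ℤ.* (+ m) ℤ.- (+ X) ℤ.* (+ y) ≡ 1ℤ
  identity = begin
    (+ x) ℤ.* (+ m) ℤ.- (+ X) ℤ.* (+ y)         ≡⟨ cong (λ z → z ℤ.- (+ X) ℤ.* (+ y)) (ℕ-identity-in-ℤ y X x m eq) ⟨
    1ℤ ℤ.+ (+ y) ℤ.* (+ X) ℤ.- (+ X) ℤ.* (+ y)  ≡⟨ cancel (+ y) (+ X) ⟩
    1ℤ                                        ∎
... | Bézout.-+ x y eq = ℤ.- (+ x) , ℤ.- (+ y) , identity
  where
  open ≡-Reasoning
  reorder : ∀ x m X y → ℤ.- x ℤ.* m ℤ.- X ℤ.* ℤ.- y ≡ y ℤ.* X ℤ.- x ℤ.* m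
  reorder = ℤ-Solver.solve-∀
  cancel : ∀ z → 1ℤ ℤ.+ z ℤ.- z ≡ 1ℤ
  cancel = ℤ-Solver.solve-∀
  identity : ℤ.- (+ x) ℤ.* (+ m) ℤ.- (+ X) ℤ.* ℤ.- (+ y) ≡ 1ℤ
  identity = begin
    ℤ.- (+ x) ℤ.* (+ m) ℤ.- (+ X) ℤ.* ℤ.- (+ y)  ≡⟨ reorder (+ x) (+ m) (+ X) (+ y) ⟩
    (+ y) ℤ.* (+ X) ℤ.- (+ x) ℤ.* (+ m)          ≡⟨ cong (λ z → z ℤ.- (+ x) ℤ.* (+ m)) (ℕ-identity-in-ℤ x m y X eq) ⟨
    1ℤ ℤ.+ (+ x) ℤ.* (+ m) ℤ.- (+ x) ℤ.* (+ m)   ≡⟨ cancel ((+ x) ℤ.* (+ m)) ⟩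
    1ℤ                                         ∎
bézout -[1+ m ] X coprime with bézout (+ suc m) X coprime
... | s , t , eq = ℤ.- s , t , trans (cong (λ z → z ℤ.- (+ X) ℤ.* t) (neg*neg s (+ suc m))) eq
  where
  neg*neg : ∀ s a → ℤ.- s ℤ.* ℤ.- a ≡ s ℤ.* a
  neg*neg = ℤ-Solver.solve-∀

-- The last condition says that (x, y, 0, 0) is not a multiple of (t₁, t₂, w₁, w₂).
record UnimodularAnnihilator (w₁ w₂ t₁ t₂ : ℚ) : Set where
  field
    s t x y      : ℤ
    det≡1        : ι s * ι y - ι x * ι t ≡ 1ℚ
    annihilates  : ι x * w₁ + ι y * w₂ ≡ 0ℚ
    not-multiple : ∀ l → ι x ≡ l * t₁ → ι y ≡ l * t₂ → l * w₁ ≡ 0ℚ → l * w₂ ≡ 0ℚ → ⊥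

private
  multiplier≡0 : ∀ l {w} → w ≢ 0ℚ → l * w ≡ 0ℚ → l ≡ 0ℚ
  multiplier≡0 l {w} w≢0 lw≡0 = begin
    l                ≡⟨ QP.*-identityʳ l ⟨
    l * 1ℚ           ≡⟨ cong (l *_) (QP.*-inverseʳ w) ⟨
    l * (w * w⁻¹)    ≡⟨ QP.*-assoc l w w⁻¹ ⟨
    l * w * w⁻¹      ≡⟨ cong (_* w⁻¹) lw≡0 ⟩
    0ℚ * w⁻¹         ≡⟨ QP.*-zeroˡ w⁻¹ ⟩
    0ℚ               ∎
    where
    open ≡-Reasoning
    instance _ = Q.≢-nonZero w≢0
    w⁻¹ = 1/ w

  zero-multiple : ∀ l {w} → w ≢ 0ℚ → l * w ≡ 0ℚ → ∀ t → l * t ≡ 0ℚ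
  zero-multiple l w≢0 lw≡0 t = trans (cong (_* t) (multiplier≡0 l w≢0 lw≡0)) (QP.*-zeroˡ t)

  numerator-coprime : ∀ r → Coprime ℤ.∣ Q.ℚ.numerator r ∣ (Q.ℚ.denominatorℕ r)
  numerator-coprime (mkℚ _ _ coprime) = recompute coprime

  unimodular-row≢0 : ∀ s t {x y} → s * y - x * t ≡ 1ℚ → x ≡ 0ℚ → y ≡ 0ℚ → ⊥
  unimodular-row≢0 s t det refl refl = case trans (sym (s*0-0*t≡0 s t)) det of λ ()
    where
    s*0-0*t≡0 : ∀ s t → s * 0ℚ - 0ℚ * t ≡ 0ℚ
    s*0-0*t≡0 = solve-∀ ℚ-ring

-- (x, y) = (X, a) where a / X = - w₁ / w₂ in lowest terms, and (s, t) comes from Bézout for a and X.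
unimodularAnnihilator-w₂≢0 : ∀ {w₁ w₂} t₁ t₂ → w₂ ≢ 0ℚ → UnimodularAnnihilator w₁ w₂ t₁ t₂
unimodularAnnihilator-w₂≢0 {w₁} {w₂} t₁ t₂ w₂≢0 = record
  { s = s ; t = t ; x = + X ; y = a
  ; det≡1 = det≡1
  ; annihilates = annihilates
  ; not-multiple = λ l x≡ y≡ _ lw₂≡0 →
      unimodular-row≢0 (ι s) (ι t) det≡1 (trans x≡ (zero-multiple l w₂≢0 lw₂≡0 t₁))
                                          (trans y≡ (zero-multiple l w₂≢0 lw₂≡0 t₂))
  }
  where
  instance _ = Q.≢-nonZero w₂≢0
  r = - (w₁ * 1/ w₂)
  X = Q.ℚ.denominatorℕ r
  a = Q.ℚ.numerator r
  bz = bézout a X (numerator-coprime r)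
  s = proj₁ bz
  t = proj₁ (proj₂ bz)
  det≡1 : ι s * ι a - ι (+ X) * ι t ≡ 1ℚ
  det≡1 = trans (sym (ι-homo-det s a (+ X) t)) (cong ι (proj₂ (proj₂ bz)))
  annihilates : ι (+ X) * w₁ + ι a * w₂ ≡ 0ℚ
  annihilates = begin
    ι (+ X) * w₁ + ι a * w₂                       ≡⟨ cong (λ z → ι (+ X) * w₁ + z * w₂) (denominator*≡numerator r) ⟨
    ι (+ X) * w₁ + ι (+ X) * - (w₁ * 1/ w₂) * w₂  ≡⟨ factor (ι (+ X)) w₁ w₂ (1/ w₂) ⟩
    ι (+ X) * w₁ * (1ℚ - 1/ w₂ * w₂)              ≡⟨ cong (λ z → ι (+ X) * w₁ * (1ℚ - z)) (QP.*-inverseˡ w₂) ⟩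
    ι (+ X) * w₁ * (1ℚ - 1ℚ)                      ≡⟨ vanish (ι (+ X) * w₁) ⟩
    0ℚ                                            ∎
    where
    open ≡-Reasoning
    factor : ∀ c w₁ w₂ v → c * w₁ + c * - (w₁ * v) * w₂ ≡ c * w₁ * (1ℚ - v * w₂)
    factor = solve-∀ ℚ-ring
    vanish : ∀ c → c * (1ℚ - 1ℚ) ≡ 0ℚ
    vanish = solve-∀ ℚ-ring

unimodularAnnihilator : ∀ w₁ w₂ t₁ t₂ → UnimodularAnnihilator w₁ w₂ t₁ t₂
unimodularAnnihilator w₁ w₂ t₁ t₂ with w₂ QP.≟ 0ℚ
... | no w₂≢0 = unimodularAnnihilator-w₂≢0 t₁ t₂ w₂≢0
... | yes refl with w₁ QP.≟ 0ℚ
...   | no w₁≢0 = record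
  { s = 1ℤ ; t = + 0 ; x = + 0 ; y = 1ℤ
  ; det≡1 = refl
  ; annihilates = trans (cong₂ _+_ (QP.*-zeroˡ w₁) (QP.*-zeroʳ 1ℚ)) (QP.+-identityˡ 0ℚ)
  ; not-multiple = λ l x≡ y≡ lw₁≡0 _ → unimodular-row≢0 1ℚ 0ℚ refl
      (trans x≡ (zero-multiple l w₁≢0 lw₁≡0 t₁)) (trans y≡ (zero-multiple l w₁≢0 lw₁≡0 t₂))
  }
...   | yes refl with t₂ QP.≟ 0ℚ
...     | yes refl = record
  { s = 1ℤ ; t = + 0 ; x = + 0 ; y = 1ℤ
  ; det≡1 = refl
  ; annihilates = refl
  ; not-multiple = λ l _ y≡ _ _ → case trans y≡ (QP.*-zeroʳ l) of λ ()
  }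
...     | no t₂≢0 = record
  { s = + 0 ; t = ℤ.- 1ℤ ; x = 1ℤ ; y = + 0
  ; det≡1 = refl
  ; annihilates = refl
  ; not-multiple = λ l x≡ y≡ _ _ → unimodular-row≢0 0ℚ (- 1ℚ) refl
      (trans x≡ (zero-multiple l t₂≢0 (sym y≡) t₁)) refl
  }

dot : ∀ {m} → Vector ℚ m → Vector ℚ m → ℚ
dot x y = sumℚ (λ k → x k * y k)

dot-· : ∀ {m} (A : Mat m) x y → dot (A · x) y ≡ dot x (transpose A · y)
dot-· A x y = begin
  sumℚ (λ k → sumℚ (λ i → A k i * x i) * y k)   ≡⟨ sumℚ-cong (λ k → *-distribʳ-sumℚ (y k) (λ i → A k i * x i)) ⟩
  sumℚ (λ k → sumℚ (λ i → A k i * x i * y k))   ≡⟨ sumℚ-comm (λ k i → A k i * x i * y k) ⟩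
  sumℚ (λ i → sumℚ (λ k → A k i * x i * y k))   ≡⟨ sumℚ-cong (λ i → sumℚ-cong (λ k → swap (A k i) (x i) (y k))) ⟩
  sumℚ (λ i → sumℚ (λ k → x i * (A k i * y k))) ≡⟨ sumℚ-cong (λ i → *-distribˡ-sumℚ (x i) (λ k → A k i * y k)) ⟨
  sumℚ (λ i → x i * sumℚ (λ k → A k i * y k))   ∎
  where
  open ≡-Reasoning
  swap : ∀ a x y → a * x * y ≡ x * (a * y)
  swap = solve-∀ ℚ-ring

dot-cong : ∀ {m} {x x′ y y′ : Vector ℚ m} → (∀ k → x k ≡ x′ k) → (∀ k → y k ≡ y′ k) → dot x y ≡ dot x′ y′
dot-cong x≗x′ y≗y′ = sumℚ-cong (λ k → cong₂ _*_ (x≗x′ k) (y≗y′ k))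

dot-congʳ : ∀ {m} (x : Vector ℚ m) {y y′} → (∀ k → y k ≡ y′ k) → dot x y ≡ dot x y′
dot-congʳ x y≗y′ = sumℚ-cong (λ k → cong (x k *_) (y≗y′ k))

·-inverse : ∀ {m} {B C : Mat m} → B ⊗ C ≈M δ → ∀ v k → (B · (C · v)) k ≡ v k
·-inverse {B = B} {C} BC≈I v k =
  trans (sym (·-assoc B C v k)) (trans (sumℚ-cong (λ l → cong (_* v l) (BC≈I k l))) (δ-· v k))

module Symplectic (n : ℕ) where

  V : Set
  V = Vector ℚ (n ℕ.+ n)

  -- top and bot with n fixed: n ℕ.+ n alone does not determine n
  tp bt : Fin n → Fin (n ℕ.+ n)
  tp = top
  bt = bot

  data Half : Fin (n ℕ.+ n) → Set where
    tp-half : ∀ i → Half (tp i)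
    bt-half : ∀ i → Half (bt i)

  half : ∀ x → Half x
  half x = subst Half (FP.join-splitAt n n x) (half-of (splitAt n x))
    where
    half-of : ∀ s → Half (F.join n n s)
    half-of (inj₁ i) = tp-half i
    half-of (inj₂ i) = bt-half i

  tp-injective : ∀ {i j : Fin n} → tp i ≡ tp j → i ≡ j
  tp-injective {i} {j} = FP.↑ˡ-injective n i j

  bt-injective : ∀ {i j : Fin n} → bt i ≡ bt j → i ≡ j
  bt-injective {i} {j} = FP.↑ʳ-injective n i j

  tp≢bt : ∀ {i j : Fin n} → tp i ≢ bt j
  tp≢bt {i} {j} eq with trans (sym (FP.splitAt-↑ˡ n i n)) (trans (cong (splitAt n) eq) (FP.splitAt-↑ʳ n n j))
  ... | ()

  δ-tp-tp : ∀ i j → δ (tp i) (tp j) ≡ δ i j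
  δ-tp-tp = δ-injective tp-injective

  δ-bt-bt : ∀ i j → δ (bt i) (bt j) ≡ δ i j
  δ-bt-bt = δ-injective bt-injective

  δ-tp-bt : ∀ i j → δ (tp i) (bt j) ≡ 0ℚ
  δ-tp-bt i j = δ-≢ (tp≢bt {i} {j})

  δ-bt-tp : ∀ i j → δ (bt i) (tp j) ≡ 0ℚ
  δ-bt-tp i j = δ-≢ (tp≢bt {j} {i} ∘ sym)

  J-tp-tp : ∀ i j → J n (tp i) (tp j) ≡ 0ℚ
  J-tp-tp i j rewrite FP.splitAt-↑ˡ n i n | FP.splitAt-↑ˡ n j n = refl

  J-tp-bt : ∀ i j → J n (tp i) (bt j) ≡ δ i j
  J-tp-bt i j rewrite FP.splitAt-↑ˡ n i n | FP.splitAt-↑ʳ n n j = refl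

  J-bt-tp : ∀ i j → J n (bt i) (tp j) ≡ - δ i j
  J-bt-tp i j rewrite FP.splitAt-↑ʳ n n i | FP.splitAt-↑ˡ n j n = refl

  J-bt-bt : ∀ i j → J n (bt i) (bt j) ≡ 0ℚ
  J-bt-bt i j rewrite FP.splitAt-↑ʳ n n i | FP.splitAt-↑ʳ n n j = refl

  J-tp-row : ∀ i k → J n (tp i) k ≡ δ (bt i) k
  J-tp-row i k with half k
  ... | tp-half j = trans (J-tp-tp i j) (sym (δ-bt-tp i j))
  ... | bt-half j = trans (J-tp-bt i j) (sym (δ-bt-bt i j))

  upper lower : V → Vector ℚ n
  upper x i = x (tp i)
  lower x i = x (bt i)

  sumℚ-halves : (f : V) → sumℚ f ≡ sumℚ (upper f) + sumℚ (lower f)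
  sumℚ-halves = sumℚ-splitAt n n

  -- ω x y = xᵀ J y; with this definition IsSp n M unfolds to ∀ i j → ω (col M i) (col M j) ≡ J n i j.
  covector : V → V
  covector x k = sumℚ (λ l → x l * J n l k)

  ω : V → V → ℚ
  ω x y = dot (covector x) y

  col : Mat (n ℕ.+ n) → Fin (n ℕ.+ n) → V
  col M j i = M i j

  covector-tp : ∀ x j → covector x (tp j) ≡ - x (bt j)
  covector-tp x j = begin
    covector x (tp j)
      ≡⟨ sumℚ-halves _ ⟩
    sumℚ (λ i → x (tp i) * J n (tp i) (tp j)) + sumℚ (λ i → x (bt i) * J n (bt i) (tp j))
      ≡⟨ cong₂ _+_ (sumℚ-zero (λ i → trans (cong (x (tp i) *_) (J-tp-tp i j)) (QP.*-zeroʳ (x (tp i)))))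
                   (sumℚ-cong (λ i → trans (cong (x (bt i) *_) (J-bt-tp i j))
                                           (sym (QP.neg-distribʳ-* (x (bt i)) (δ i j))))) ⟩
    0ℚ + sumℚ (λ i → - (x (bt i) * δ i j))
      ≡⟨ QP.+-identityˡ _ ⟩
    sumℚ (λ i → - (x (bt i) * δ i j))
      ≡⟨ neg-distrib-sumℚ (λ i → x (bt i) * δ i j) ⟨
    - sumℚ (λ i → x (bt i) * δ i j)
      ≡⟨ cong -_ (sumℚ-δʳ j (lower x)) ⟩
    - x (bt j) ∎
    where open ≡-Reasoning

  covector-bt : ∀ x j → covector x (bt j) ≡ x (tp j)
  covector-bt x j = begin
    covector x (bt j)
      ≡⟨ sumℚ-halves _ ⟩
    sumℚ (λ i → x (tp i) * J n (tp i) (bt j)) + sumℚ (λ i → x (bt i) * J n (bt i) (bt j))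
      ≡⟨ cong₂ _+_ (sumℚ-cong (λ i → cong (x (tp i) *_) (J-tp-bt i j)))
                   (sumℚ-zero (λ i → trans (cong (x (bt i) *_) (J-bt-bt i j)) (QP.*-zeroʳ (x (bt i))))) ⟩
    sumℚ (λ i → x (tp i) * δ i j) + 0ℚ
      ≡⟨ QP.+-identityʳ _ ⟩
    sumℚ (λ i → x (tp i) * δ i j)
      ≡⟨ sumℚ-δʳ j (upper x) ⟩
    x (tp j) ∎
    where open ≡-Reasoning

  ω-coordinates : ∀ x y → ω x y ≡ dot (upper x) (lower y) - dot (lower x) (upper y)
  ω-coordinates x y = begin
    ω x y
      ≡⟨ sumℚ-halves _ ⟩
    sumℚ (λ j → covector x (tp j) * y (tp j)) + sumℚ (λ j → covector x (bt j) * y (bt j))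
      ≡⟨ cong₂ _+_ (sumℚ-cong (λ j → trans (cong (_* y (tp j)) (covector-tp x j))
                                           (sym (QP.neg-distribˡ-* (x (bt j)) (y (tp j))))))
                   (sumℚ-cong (λ j → cong (_* y (bt j)) (covector-bt x j))) ⟩
    sumℚ (λ j → - (x (bt j) * y (tp j))) + dot (upper x) (lower y)
      ≡⟨ cong (_+ dot (upper x) (lower y)) (neg-distrib-sumℚ (λ j → x (bt j) * y (tp j))) ⟨
    - dot (lower x) (upper y) + dot (upper x) (lower y)
      ≡⟨ QP.+-comm (- dot (lower x) (upper y)) (dot (upper x) (lower y)) ⟩
    dot (upper x) (lower y) - dot (lower x) (upper y) ∎
    where open ≡-Reasoning

  ω-antisym : ∀ x y → ω y x ≡ - ω x y
  ω-antisym x y = begin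
    ω y x
      ≡⟨ ω-coordinates y x ⟩
    dot (upper y) (lower x) - dot (lower y) (upper x)
      ≡⟨ cong₂ _-_ (dot-comm (upper y) (lower x)) (dot-comm (lower y) (upper x)) ⟩
    dot (lower x) (upper y) - dot (upper x) (lower y)
      ≡⟨ flip (dot (upper x) (lower y)) (dot (lower x) (upper y)) ⟩
    - (dot (upper x) (lower y) - dot (lower x) (upper y))
      ≡⟨ cong -_ (ω-coordinates x y) ⟨
    - ω x y ∎
    where
    open ≡-Reasoning
    dot-comm : ∀ (u v : Vector ℚ n) → dot u v ≡ dot v u
    dot-comm u v = sumℚ-cong (λ k → QP.*-comm (u k) (v k))
    flip : ∀ a b → b - a ≡ - (a - b)
    flip = solve-∀ ℚ-ring

  ω-self : ∀ x → ω x x ≡ 0ℚ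
  ω-self x = begin
    ω x x
      ≡⟨ ω-coordinates x x ⟩
    dot (upper x) (lower x) - dot (lower x) (upper x)
      ≡⟨ cong (λ z → dot (upper x) (lower x) - z) (sumℚ-cong (λ k → QP.*-comm (x (bt k)) (x (tp k)))) ⟩
    dot (upper x) (lower x) - dot (upper x) (lower x)
      ≡⟨ QP.+-inverseʳ (dot (upper x) (lower x)) ⟩
    0ℚ ∎
    where open ≡-Reasoning

  ω-unit : ∀ x k → ω x (unit k) ≡ covector x k
  ω-unit x k = sumℚ-δʳ k (covector x)

  ω-unit-tp : ∀ x j → ω x (unit (tp j)) ≡ - x (bt j)
  ω-unit-tp x j = trans (ω-unit x (tp j)) (covector-tp x j)

  ω-unit-bt : ∀ x j → ω x (unit (bt j)) ≡ x (tp j)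
  ω-unit-bt x j = trans (ω-unit x (bt j)) (covector-bt x j)

  unit-tp-ω : ∀ y j → ω (unit (tp j)) y ≡ y (bt j)
  unit-tp-ω y j = trans (ω-antisym y (unit (tp j))) (trans (cong -_ (ω-unit-tp y j)) (neg-involutive _))

  unit-bt-ω : ∀ y j → ω (unit (bt j)) y ≡ - y (tp j)
  unit-bt-ω y j = trans (ω-antisym y (unit (bt j))) (cong -_ (ω-unit-bt y j))

  ω-unit-unit : ∀ i j → ω (unit i) (unit j) ≡ J n i j
  ω-unit-unit i j = trans (ω-unit (unit i) j) (sumℚ-δˡ i (λ l → J n l j))

  ω-cong : ∀ {x x′ y y′ : V} → (∀ k → x k ≡ x′ k) → (∀ k → y k ≡ y′ k) → ω x y ≡ ω x′ y′
  ω-cong x≗x′ y≗y′ = sumℚ-cong (λ k → cong₂ _*_ (sumℚ-cong (λ l → cong (_* J n l k) (x≗x′ l))) (y≗y′ k))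

  ω-zeroʳ : ∀ x {y : V} → (∀ k → y k ≡ 0ℚ) → ω x y ≡ 0ℚ
  ω-zeroʳ x y≡0 = sumℚ-zero (λ k → trans (cong (covector x k *_) (y≡0 k)) (QP.*-zeroʳ (covector x k)))

  ω-linearʳ : ∀ x {w : V} α y β z → (∀ k → w k ≡ α * y k + β * z k) → ω x w ≡ α * ω x y + β * ω x z
  ω-linearʳ x {w} α y β z w≗ = begin
    ω x w
      ≡⟨ sumℚ-cong (λ k → trans (cong (covector x k *_) (w≗ k)) (distrib (covector x k) α (y k) β (z k))) ⟩
    sumℚ (λ k → α * (covector x k * y k) + β * (covector x k * z k))
      ≡⟨ sumℚ-linear α β (λ k → covector x k * y k) (λ k → covector x k * z k) ⟩
    α * ω x y + β * ω x z ∎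
    where
    open ≡-Reasoning
    distrib : ∀ c α y β z → c * (α * y + β * z) ≡ α * (c * y) + β * (c * z)
    distrib = solve-∀ ℚ-ring

  ω-linearˡ : ∀ {w : V} α x β y z → (∀ k → w k ≡ α * x k + β * y k) → ω w z ≡ α * ω x z + β * ω y z
  ω-linearˡ {w} α x β y z w≗ = begin
    ω w z                         ≡⟨ ω-antisym z w ⟩
    - ω z w                       ≡⟨ cong -_ (ω-linearʳ z α x β y w≗) ⟩
    - (α * ω z x + β * ω z y)     ≡⟨ cong₂ (λ a b → - (α * a + β * b)) (ω-antisym x z) (ω-antisym y z) ⟩
    - (α * - ω x z + β * - ω y z) ≡⟨ negate α (ω x z) β (ω y z) ⟩
    α * ω x z + β * ω y z         ∎
    where
    open ≡-Reasoning
    negate : ∀ α a β b → - (α * - a + β * - b) ≡ α * a + β * b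
    negate = solve-∀ ℚ-ring

  ω≡dot-J· : ∀ x y → ω x y ≡ dot x (J n · y)
  ω≡dot-J· x y = trans (sumℚ-cong (λ k → cong (_* y k) (sumℚ-cong (λ l → QP.*-comm (x l) (J n l k)))))
                       (dot-· (transpose (J n)) x y)

  ω-· : ∀ {A} → IsSp n A → ∀ x y → ω (A · x) (A · y) ≡ ω x y
  ω-· {A} A-sp x y = begin
    ω (A · x) (A · y)                         ≡⟨ ω≡dot-J· (A · x) (A · y) ⟩
    dot (A · x) (J n · (A · y))               ≡⟨ dot-· A x (J n · (A · y)) ⟩
    dot x (transpose A · (J n · (A · y)))     ≡⟨ dot-congʳ x (λ i → trans (·-assoc (transpose A ⊗ J n) A y i)
                                                                          (·-assoc (transpose A) (J n) (A · y) i)) ⟨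
    dot x ((transpose A ⊗ J n ⊗ A) · y)       ≡⟨ dot-congʳ x (λ i → sumℚ-cong (λ k → cong (_* y k) (A-sp i k))) ⟩
    dot x (J n · y)                           ≡⟨ ω≡dot-J· x y ⟨
    ω x y                                     ∎
    where open ≡-Reasoning

  ω-preserving⇒IsSp : ∀ {A} → (∀ x y → ω (A · x) (A · y) ≡ ω x y) → IsSp n A
  ω-preserving⇒IsSp {A} preserves i j = begin
    ω (col A i) (col A j)        ≡⟨ ω-cong (λ k → sym (·-unit A i k)) (λ k → sym (·-unit A j k)) ⟩
    ω (A · unit i) (A · unit j)  ≡⟨ preserves (unit i) (unit j) ⟩
    ω (unit i) (unit j)          ≡⟨ ω-unit-unit i j ⟩
    J n i j                      ∎
    where open ≡-Reasoning

  IsSp-⊗ : ∀ {A B} → IsSp n A → IsSp n B → IsSp n (A ⊗ B)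
  IsSp-⊗ {A} {B} A-sp B-sp = ω-preserving⇒IsSp λ x y → begin
    ω ((A ⊗ B) · x) ((A ⊗ B) · y)  ≡⟨ ω-cong (·-assoc A B x) (·-assoc A B y) ⟩
    ω (A · (B · x)) (A · (B · y))  ≡⟨ ω-· A-sp (B · x) (B · y) ⟩
    ω (B · x) (B · y)              ≡⟨ ω-· B-sp x y ⟩
    ω x y                          ∎
    where open ≡-Reasoning

  IsSp-δ : IsSp n δ
  IsSp-δ = ω-preserving⇒IsSp λ x y → ω-cong (δ-· x) (δ-· y)

  IsSp-surjective : ∀ {A} → IsSp n A → Surjective A
  IsSp-surjective {A} A-sp with singular⊎surjective A
  ... | inj₂ A-onto = A-onto
  ... | inj₁ (x , Ax≡0 , i , xᵢ≢0) = ⊥-elim (xᵢ≢0 (x≡0 i))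
    where
    ω-unit-x≡0 : ∀ k → ω (unit k) x ≡ 0ℚ
    ω-unit-x≡0 k = trans (sym (ω-· A-sp (unit k) x)) (ω-zeroʳ (A · unit k) Ax≡0)
    x≡0 : ∀ k → x k ≡ 0ℚ
    x≡0 k with half k
    ... | tp-half j = trans (sym (neg-involutive (x (tp j)))) (cong -_ (trans (sym (unit-bt-ω x j)) (ω-unit-x≡0 (bt j))))
    ... | bt-half j = trans (sym (unit-tp-ω x j)) (ω-unit-x≡0 (tp j))

module Transvections (n : ℕ) where
  open Symplectic n

  transvection : V → ℚ → Mat (n ℕ.+ n)
  transvection v c i k = δ i k + c * covector v k * v i

  transvection-· : ∀ v c y i → (transvection v c · y) i ≡ y i + c * ω v y * v i
  transvection-· v c y i = begin
    sumℚ (λ k → (δ i k + c * covector v k * v i) * y k)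
      ≡⟨ sumℚ-cong (λ k → trans (cong (λ d → (d + c * covector v k * v i) * y k) (δ-sym i k))
                                (expand (δ k i) c (covector v k) (v i) (y k))) ⟩
    sumℚ (λ k → 1ℚ * (δ k i * y k) + c * v i * (covector v k * y k))
      ≡⟨ sumℚ-linear 1ℚ (c * v i) (λ k → δ k i * y k) (λ k → covector v k * y k) ⟩
    1ℚ * sumℚ (λ k → δ k i * y k) + c * v i * ω v y
      ≡⟨ cong (λ s → 1ℚ * s + c * v i * ω v y) (sumℚ-δˡ i y) ⟩
    1ℚ * y i + c * v i * ω v y
      ≡⟨ reorder (y i) c (v i) (ω v y) ⟩
    y i + c * ω v y * v i ∎
    where
    open ≡-Reasoning
    expand : ∀ d c a x y → (d + c * a * x) * y ≡ 1ℚ * (d * y) + c * x * (a * y)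
    expand = solve-∀ ℚ-ring
    reorder : ∀ y c x w → 1ℚ * y + c * x * w ≡ y + c * w * x
    reorder = solve-∀ ℚ-ring

  IsSp-transvection : ∀ v c → IsSp n (transvection v c)
  IsSp-transvection v c = ω-preserving⇒IsSp λ y z → begin
    ω (T · y) (T · z)
      ≡⟨ ω-linearˡ 1ℚ y (a y) v (T · z) (T·-combination y) ⟩
    1ℚ * ω y (T · z) + a y * ω v (T · z)
      ≡⟨ cong₂ (λ p q → 1ℚ * p + a y * q) (ω-linearʳ y 1ℚ z (a z) v (T·-combination z))
                                          (ω-linearʳ v 1ℚ z (a z) v (T·-combination z)) ⟩
    1ℚ * (1ℚ * ω y z + a z * ω y v) + a y * (1ℚ * ω v z + a z * ω v v)
      ≡⟨ cong₂ (λ p q → 1ℚ * (1ℚ * ω y z + a z * p) + a y * (1ℚ * ω v z + a z * q)) (ω-antisym v y) (ω-self v) ⟩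
    1ℚ * (1ℚ * ω y z + c * ω v z * - ω v y) + c * ω v y * (1ℚ * ω v z + c * ω v z * 0ℚ)
      ≡⟨ cancel (ω y z) c (ω v y) (ω v z) ⟩
    ω y z ∎
    where
    open ≡-Reasoning
    T = transvection v c
    a : V → ℚ
    a y = c * ω v y
    T·-combination : ∀ y k → (T · y) k ≡ 1ℚ * y k + a y * v k
    T·-combination y k = trans (transvection-· v c y k) (cong (_+ a y * v k) (sym (QP.*-identityˡ (y k))))
    cancel : ∀ w c p q → 1ℚ * (1ℚ * w + c * q * - p) + c * p * (1ℚ * q + c * q * 0ℚ) ≡ w
    cancel = solve-∀ ℚ-ring

  transvection-sending : (u w : V) → ω w u ≢ 0ℚ → Mat (n ℕ.+ n)
  transvection-sending u w ω≢0 = transvection (λ k → w k - u k) ((1/ ω w u) {{Q.≢-nonZero ω≢0}})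

  transvection-sending-· : ∀ u w ω≢0 i → (transvection-sending u w ω≢0 · u) i ≡ w i
  transvection-sending-· u w ω≢0 i = begin
    (transvection-sending u w ω≢0 · u) i
      ≡⟨ transvection-· (λ k → w k - u k) c u i ⟩
    u i + c * ω (λ k → w k - u k) u * (w i - u i)
      ≡⟨ cong (λ s → u i + c * s * (w i - u i)) ω-difference ⟩
    u i + c * ω w u * (w i - u i)
      ≡⟨ cong (λ s → u i + s * (w i - u i)) (QP.*-inverseˡ (ω w u) {{Q.≢-nonZero ω≢0}}) ⟩
    u i + 1ℚ * (w i - u i)
      ≡⟨ cancel (u i) (w i) ⟩
    w i ∎
    where
    open ≡-Reasoning
    c = (1/ ω w u) {{Q.≢-nonZero ω≢0}}
    ω-difference : ω (λ k → w k - u k) u ≡ ω w u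
    ω-difference = begin
      ω (λ k → w k - u k) u          ≡⟨ ω-linearˡ 1ℚ w (- 1ℚ) u u (λ k → as-combination (w k) (u k)) ⟩
      1ℚ * ω w u + - 1ℚ * ω u u      ≡⟨ cong (λ s → 1ℚ * ω w u + - 1ℚ * s) (ω-self u) ⟩
      1ℚ * ω w u + - 1ℚ * 0ℚ         ≡⟨ drop (ω w u) ⟩
      ω w u                          ∎
      where
      as-combination : ∀ w u → w - u ≡ 1ℚ * w + - 1ℚ * u
      as-combination = solve-∀ ℚ-ring
      drop : ∀ w → 1ℚ * w + - 1ℚ * 0ℚ ≡ w
      drop = solve-∀ ℚ-ring
    cancel : ∀ u w → u + 1ℚ * (w - u) ≡ w
    cancel = solve-∀ ℚ-ring

module Parabolic (n : ℕ) where
  open Symplectic n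
  open Transvections n

  FixesTop : Fin n → Mat (n ℕ.+ n) → Set
  FixesTop ℓ M = ∀ i → M i (tp ℓ) ≡ δ i (tp ℓ)

  FixesTop-⊗ : ∀ {ℓ A B} → FixesTop ℓ A → FixesTop ℓ B → FixesTop ℓ (A ⊗ B)
  FixesTop-⊗ {ℓ} {A} {B} A-fixes B-fixes i =
    trans (sumℚ-cong (λ k → cong (A i k *_) (B-fixes k))) (trans (sumℚ-δʳ (tp ℓ) (A i)) (A-fixes i))

  FixesTop-transvection : ∀ {ℓ} v c → v (bt ℓ) ≡ 0ℚ → FixesTop ℓ (transvection v c)
  FixesTop-transvection {ℓ} v c vℓ≡0 i = begin
    δ i (tp ℓ) + c * covector v (tp ℓ) * v i
      ≡⟨ cong (λ a → δ i (tp ℓ) + c * a * v i) (trans (covector-tp v ℓ) (cong -_ vℓ≡0)) ⟩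
    δ i (tp ℓ) + c * 0ℚ * v i
      ≡⟨ vanish (δ i (tp ℓ)) c (v i) ⟩
    δ i (tp ℓ) ∎
    where
    open ≡-Reasoning
    vanish : ∀ d c x → d + c * 0ℚ * x ≡ d
    vanish = solve-∀ ℚ-ring

  FixesTop⇒fixes-row : ∀ {ℓ M} → IsSp n M → FixesTop ℓ M → ∀ j → M (bt ℓ) j ≡ δ (bt ℓ) j
  FixesTop⇒fixes-row {ℓ} {M} M-sp fixes j = begin
    M (bt ℓ) j                     ≡⟨ unit-tp-ω (col M j) ℓ ⟨
    ω (unit (tp ℓ)) (col M j)      ≡⟨ ω-cong (λ i → sym (fixes i)) (λ _ → refl) ⟩
    ω (col M (tp ℓ)) (col M j)     ≡⟨ M-sp (tp ℓ) j ⟩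
    J n (tp ℓ) j                   ≡⟨ J-tp-row ℓ j ⟩
    δ (bt ℓ) j                     ∎
    where open ≡-Reasoning

  IsSp∧FixesTop⇒InP : ∀ {ℓ M} → toℕ ℓ ≡ n ℕ.∸ 1 → IsSp n M → FixesTop ℓ M → InP n M
  IsSp∧FixesTop⇒InP {ℓ} {M} ℓ-last M-sp fixes =
      M-sp
    , (λ i j i-not-last j-last → at-last j-last (λ j → M (tp i) (tp j) ≡ 0ℚ)
        (trans (fixes (tp i)) (trans (δ-tp-tp i ℓ) (δ-≢ (not-last i-not-last)))))
    , (λ i j _ j-last → at-last j-last (λ j → M (bt i) (tp j) ≡ 0ℚ) (trans (fixes (bt i)) (δ-bt-tp i ℓ)))
    , (λ i j i-last → at-last i-last (λ i → M (bt i) (tp j) ≡ 0ℚ) (trans (row (tp j)) (δ-bt-tp ℓ j)))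
    , (λ i j i-last j-not-last → at-last i-last (λ i → M (bt i) (bt j) ≡ 0ℚ)
        (trans (row (bt j)) (trans (δ-bt-bt ℓ j) (δ-≢ (not-last j-not-last ∘ sym)))))
    where
    row = FixesTop⇒fixes-row M-sp fixes
    at-last : ∀ {j} → toℕ j ≡ n ℕ.∸ 1 → (P : Fin n → Set) → P ℓ → P j
    at-last j-last P Pℓ = subst P (FP.toℕ-injective (trans ℓ-last (sym j-last))) Pℓ
    not-last : ∀ {i} → toℕ i ≢ n ℕ.∸ 1 → i ≢ ℓ
    not-last i-not-last i≡ℓ = i-not-last (trans (cong toℕ i≡ℓ) ℓ-last)

module Reachability (n : ℕ) (ℓ z : Fin n) (z≢ℓ : z ≢ ℓ) where
  open Symplectic n
  open Transvections n
  open Parabolic n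

  Reachable : V → Set
  Reachable u = ∃ λ p → IsSp n p × FixesTop ℓ p × (∀ i → p i (tp z) ≡ u i)

  reachable-unit : Reachable (unit (tp z))
  reachable-unit = δ , IsSp-δ , (λ _ → refl) , (λ _ → refl)

  reachable-step : ∀ {u w} → Reachable u → u (bt ℓ) ≡ 0ℚ → w (bt ℓ) ≡ 0ℚ → ω w u ≢ 0ℚ → Reachable w
  reachable-step {u} {w} (p , p-sp , p-fixes , p-sends) uℓ≡0 wℓ≡0 ω≢0 =
      τ ⊗ p
    , IsSp-⊗ {τ} {p} (IsSp-transvection w-u c) p-sp
    , FixesTop-⊗ {ℓ} {τ} {p} (FixesTop-transvection w-u c (cong₂ _-_ wℓ≡0 uℓ≡0)) p-fixes
    , λ i → trans (·-congʳ τ p-sends i) (transvection-sending-· u w ω≢0 i)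
    where
    w-u : V
    w-u k = w k - u k
    c = (1/ ω w u) {{Q.≢-nonZero ω≢0}}
    τ = transvection-sending u w ω≢0

  -- One transvection reaches u from e_z when ω u e_z ≢ 0; otherwise two, through an m with m_{n+z} ≢ 0 and ω u m ≢ 0.
  reachable-via : ∀ {u} m → u (bt ℓ) ≡ 0ℚ → m (bt ℓ) ≡ 0ℚ → m (bt z) ≢ 0ℚ → ω u m ≢ 0ℚ → Reachable u
  reachable-via {u} m uℓ≡0 mℓ≡0 mz≢0 ω≢0 =
    reachable-step {m} {u} (reachable-step reachable-unit (δ-bt-tp ℓ z) mℓ≡0 ω-m-e≢0) mℓ≡0 uℓ≡0 ω≢0
    where
    ω-m-e≢0 : ω m (unit (tp z)) ≢ 0ℚ
    ω-m-e≢0 eq = mz≢0 (QP.neg-injective {_} {0ℚ} (trans (sym (ω-unit-tp m z)) eq))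

  reachable-via-bt-z : ∀ {u} c k′ → u (bt ℓ) ≡ 0ℚ → k′ ≢ bt ℓ → k′ ≢ bt z →
    u (tp z) + c * ω u (unit k′) ≢ 0ℚ → Reachable u
  reachable-via-bt-z {u} c k′ uℓ≡0 k′≢ℓ k′≢z ω≢0 = reachable-via m uℓ≡0 mℓ≡0 mz≢0 (ω≢0 ∘ trans (sym ω-u-m))
    where
    m : V
    m i = unit (bt z) i + c * unit k′ i
    mℓ≡0 : m (bt ℓ) ≡ 0ℚ
    mℓ≡0 = trans (cong₂ (λ a b → a + c * b) (trans (δ-bt-bt ℓ z) (δ-≢ (z≢ℓ ∘ sym))) (δ-≢ (k′≢ℓ ∘ sym)))
                 (trans (QP.+-identityˡ (c * 0ℚ)) (QP.*-zeroʳ c))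
    mz≡1 : m (bt z) ≡ 1ℚ
    mz≡1 = trans (cong₂ (λ a b → a + c * b) (δ-refl (bt z)) (δ-≢ (k′≢z ∘ sym)))
                 (trans (cong (λ s → 1ℚ + s) (QP.*-zeroʳ c)) (QP.+-identityʳ 1ℚ))
    mz≢0 : m (bt z) ≢ 0ℚ
    mz≢0 eq = case trans (sym mz≡1) eq of λ ()
    ω-u-m : ω u m ≡ u (tp z) + c * ω u (unit k′)
    ω-u-m = trans (ω-linearʳ u 1ℚ (unit (bt z)) c (unit k′)
                             (λ i → cong (_+ c * unit k′ i) (sym (QP.*-identityˡ (unit (bt z) i)))))
                  (cong (_+ c * ω u (unit k′)) (trans (QP.*-identityˡ _) (ω-unit-bt u z)))

  reachable : ∀ u → u (bt ℓ) ≡ 0ℚ → ∀ k → k ≢ tp ℓ → u k ≢ 0ℚ → Reachable u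
  reachable u uℓ≡0 k k≢ℓ uk≢0 with u (bt z) QP.≟ 0ℚ
  ... | no u-bz≢0 = reachable-step reachable-unit (δ-bt-tp ℓ z) uℓ≡0
                      (λ eq → u-bz≢0 (QP.neg-injective {_} {0ℚ} (trans (sym (ω-unit-tp u z)) eq)))
  ... | yes _ with u (tp z) QP.≟ 0ℚ
  ...   | no u-tz≢0 = reachable-via-bt-z 0ℚ (tp z) uℓ≡0 tp≢bt tp≢bt
                        (u-tz≢0 ∘ trans (sym (drop (u (tp z)) (ω u (unit (tp z))))))
    where
    drop : ∀ a b → a + 0ℚ * b ≡ a
    drop = solve-∀ ℚ-ring
  ...   | yes u-tz≡0 with half k
  ...     | tp-half j = reachable-via-bt-z 1ℚ (bt j) uℓ≡0 (j≢ℓ ∘ bt-injective) (j≢z ∘ bt-injective)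
                          (uk≢0 ∘ trans (sym ω-u-m≡u-k))
    where
    j≢ℓ : j ≢ ℓ
    j≢ℓ = k≢ℓ ∘ cong tp
    j≢z : j ≢ z
    j≢z j≡z = uk≢0 (trans (cong (u ∘ tp) j≡z) u-tz≡0)
    ω-u-m≡u-k : u (tp z) + 1ℚ * ω u (unit (bt j)) ≡ u (tp j)
    ω-u-m≡u-k = trans (cong₂ (λ a b → a + 1ℚ * b) u-tz≡0 (ω-unit-bt u j)) (simplify (u (tp j)))
      where
      simplify : ∀ a → 0ℚ + 1ℚ * a ≡ a
      simplify = solve-∀ ℚ-ring
  ...     | bt-half j = reachable-via-bt-z (- 1ℚ) (tp j) uℓ≡0 tp≢bt tp≢bt (uk≢0 ∘ trans (sym ω-u-m≡u-k))
    where
    ω-u-m≡u-k : u (tp z) + - 1ℚ * ω u (unit (tp j)) ≡ u (bt j)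
    ω-u-m≡u-k = trans (cong₂ (λ a b → a + - 1ℚ * b) u-tz≡0 (ω-unit-tp u j)) (simplify (u (bt j)))
      where
      simplify : ∀ a → 0ℚ + - 1ℚ * - a ≡ a
      simplify = solve-∀ ℚ-ring

M0≡δ-opposite : ∀ n (i j : Fin n) → M0 n i j ≡ δ i (opposite j)
M0≡δ-opposite n i j with toℕ i ℕ.+ toℕ j ℕ.≟ n ℕ.∸ 1 | i F.≟ opposite j
... | yes _ | yes _ = refl
... | no _  | no _  = refl
... | yes i+j≡n-1 | no i≢opp = ⊥-elim (i≢opp (FP.toℕ-injective (begin
  toℕ i                      ≡⟨ ℕP.m+n∸n≡m (toℕ i) (toℕ j) ⟨
  toℕ i ℕ.+ toℕ j ℕ.∸ toℕ j  ≡⟨ cong (ℕ._∸ toℕ j) i+j≡n-1 ⟩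
  n ℕ.∸ 1 ℕ.∸ toℕ j          ≡⟨ ℕP.∸-+-assoc n 1 (toℕ j) ⟩
  n ℕ.∸ suc (toℕ j)          ≡⟨ FP.opposite-prop j ⟨
  toℕ (opposite j)           ∎)))
  where open ≡-Reasoning
... | no i+j≢n-1 | yes refl = ⊥-elim (i+j≢n-1 (begin
  toℕ (opposite j) ℕ.+ toℕ j   ≡⟨ cong (ℕ._+ toℕ j) (trans (FP.opposite-prop j) (sym (ℕP.∸-+-assoc n 1 (toℕ j)))) ⟩
  n ℕ.∸ 1 ℕ.∸ toℕ j ℕ.+ toℕ j  ≡⟨ ℕP.m∸n+n≡m (ℕP.∸-monoˡ-≤ 1 (FP.toℕ<n j)) ⟩
  n ℕ.∸ 1                      ∎))
  where open ≡-Reasoning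

module Reversal (n : ℕ) where
  open Symplectic n
  open Parabolic n

  σ : Fin (n ℕ.+ n) → Fin (n ℕ.+ n)
  σ x with splitAt n x
  ... | inj₁ i = tp (opposite i)
  ... | inj₂ i = bt (opposite i)

  σ-tp : ∀ i → σ (tp i) ≡ tp (opposite i)
  σ-tp i rewrite FP.splitAt-↑ˡ n i n = refl

  σ-bt : ∀ i → σ (bt i) ≡ bt (opposite i)
  σ-bt i rewrite FP.splitAt-↑ʳ n n i = refl

  σ-involutive : ∀ x → σ (σ x) ≡ x
  σ-involutive x with half x
  ... | tp-half i = trans (cong σ (σ-tp i)) (trans (σ-tp (opposite i)) (cong tp (FP.opposite-involutive i)))
  ... | bt-half i = trans (cong σ (σ-bt i)) (trans (σ-bt (opposite i)) (cong bt (FP.opposite-involutive i)))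

  opposite-injective : ∀ {i j : Fin n} → opposite i ≡ opposite j → i ≡ j
  opposite-injective {i} {j} eq =
    trans (sym (FP.opposite-involutive i)) (trans (cong opposite eq) (FP.opposite-involutive j))

  R≡δ-σ : ∀ x y → R n x y ≡ δ x (σ y)
  R≡δ-σ x y with half x | half y
  ... | tp-half i | tp-half j rewrite FP.splitAt-↑ˡ n i n | FP.splitAt-↑ˡ n j n =
    trans (M0≡δ-opposite n i j) (sym (δ-tp-tp i (opposite j)))
  ... | tp-half i | bt-half j rewrite FP.splitAt-↑ˡ n i n | FP.splitAt-↑ʳ n n j = sym (δ-tp-bt i (opposite j))
  ... | bt-half i | tp-half j rewrite FP.splitAt-↑ʳ n n i | FP.splitAt-↑ˡ n j n = sym (δ-bt-tp i (opposite j))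
  ... | bt-half i | bt-half j rewrite FP.splitAt-↑ʳ n n i | FP.splitAt-↑ʳ n n j =
    trans (M0≡δ-opposite n i j) (sym (δ-bt-bt i (opposite j)))

  ⊗R : ∀ X x y → (X ⊗ R n) x y ≡ X x (σ y)
  ⊗R X x y = trans (sumℚ-cong (λ k → cong (X x k *_) (R≡δ-σ k y))) (sumℚ-δʳ (σ y) (X x))

  ⊗R⊗R : ∀ X x y → ((X ⊗ R n) ⊗ R n) x y ≡ X x y
  ⊗R⊗R X x y = trans (⊗R (X ⊗ R n) x y) (trans (⊗R X x (σ y)) (cong (X x) (σ-involutive y)))

  J-σ : ∀ x y → J n (σ x) (σ y) ≡ J n x y
  J-σ x y with half x | half y
  ... | tp-half i | tp-half j rewrite σ-tp i | σ-tp j = trans (J-tp-tp (opposite i) (opposite j)) (sym (J-tp-tp i j))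
  ... | tp-half i | bt-half j rewrite σ-tp i | σ-bt j =
    trans (J-tp-bt (opposite i) (opposite j)) (trans (δ-injective opposite-injective i j) (sym (J-tp-bt i j)))
  ... | bt-half i | tp-half j rewrite σ-bt i | σ-tp j =
    trans (J-bt-tp (opposite i) (opposite j)) (trans (cong -_ (δ-injective opposite-injective i j)) (sym (J-bt-tp i j)))
  ... | bt-half i | bt-half j rewrite σ-bt i | σ-bt j = trans (J-bt-bt (opposite i) (opposite j)) (sym (J-bt-bt i j))

  IsSp-⊗R : ∀ {X} → IsSp n X → IsSp n (X ⊗ R n)
  IsSp-⊗R {X} X-sp i j = begin
    ω (col (X ⊗ R n) i) (col (X ⊗ R n) j) ≡⟨ ω-cong (λ k → ⊗R X k i) (λ k → ⊗R X k j) ⟩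
    ω (col X (σ i)) (col X (σ j))         ≡⟨ X-sp (σ i) (σ j) ⟩
    J n (σ i) (σ j)                       ≡⟨ J-σ i j ⟩
    J n i j                               ∎
    where open ≡-Reasoning

  FixesTop-⊗R : ∀ {X z} → (∀ i → X i (tp z) ≡ δ i (tp (opposite z))) → FixesTop (opposite z) (X ⊗ R n)
  FixesTop-⊗R {X} {z} sends i =
    trans (⊗R X i (tp (opposite z)))
          (trans (cong (X i) (trans (σ-tp (opposite z)) (cong tp (FP.opposite-involutive z)))) (sends i))

module BlockDiagonal (n : ℕ) where
  open Symplectic n

  diag : Mat n → Mat n → Mat (n ℕ.+ n)
  diag A D x y with splitAt n x | splitAt n y
  ... | inj₁ i | inj₁ j = A i j
  ... | inj₂ i | inj₂ j = D i j
  ... | _      | _      = 0ℚ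

  module _ (A D : Mat n) where
    diag-tp-tp : ∀ i j → diag A D (tp i) (tp j) ≡ A i j
    diag-tp-tp i j rewrite FP.splitAt-↑ˡ n i n | FP.splitAt-↑ˡ n j n = refl

    diag-bt-bt : ∀ i j → diag A D (bt i) (bt j) ≡ D i j
    diag-bt-bt i j rewrite FP.splitAt-↑ʳ n n i | FP.splitAt-↑ʳ n n j = refl

    diag-tp-bt : ∀ i j → diag A D (tp i) (bt j) ≡ 0ℚ
    diag-tp-bt i j rewrite FP.splitAt-↑ˡ n i n | FP.splitAt-↑ʳ n n j = refl

    diag-bt-tp : ∀ i j → diag A D (bt i) (tp j) ≡ 0ℚ
    diag-bt-tp i j rewrite FP.splitAt-↑ʳ n n i | FP.splitAt-↑ˡ n j n = refl

    diag-·-tp : ∀ v i → (diag A D · v) (tp i) ≡ (A · upper v) i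
    diag-·-tp v i = begin
      (diag A D · v) (tp i)                     ≡⟨ sumℚ-halves (λ k → diag A D (tp i) k * v k) ⟩
      sumℚ (λ j → diag A D (tp i) (tp j) * v (tp j)) + sumℚ (λ j → diag A D (tp i) (bt j) * v (bt j))
        ≡⟨ cong₂ _+_ (sumℚ-cong (λ j → cong (_* v (tp j)) (diag-tp-tp i j)))
                     (sumℚ-zero (λ j → trans (cong (_* v (bt j)) (diag-tp-bt i j)) (QP.*-zeroˡ (v (bt j))))) ⟩
      (A · upper v) i + 0ℚ                      ≡⟨ QP.+-identityʳ _ ⟩
      (A · upper v) i                           ∎
      where open ≡-Reasoning

    diag-·-bt : ∀ v i → (diag A D · v) (bt i) ≡ (D · lower v) i
    diag-·-bt v i = begin
      (diag A D · v) (bt i)                     ≡⟨ sumℚ-halves (λ k → diag A D (bt i) k * v k) ⟩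
      sumℚ (λ j → diag A D (bt i) (tp j) * v (tp j)) + sumℚ (λ j → diag A D (bt i) (bt j) * v (bt j))
        ≡⟨ cong₂ _+_ (sumℚ-zero (λ j → trans (cong (_* v (tp j)) (diag-bt-tp i j)) (QP.*-zeroˡ (v (tp j)))))
                     (sumℚ-cong (λ j → cong (_* v (bt j)) (diag-bt-bt i j))) ⟩
      0ℚ + (D · lower v) i                      ≡⟨ QP.+-identityˡ _ ⟩
      (D · lower v) i                           ∎
      where open ≡-Reasoning

    IsSp-diag : transpose A ⊗ D ≈M δ → IsSp n (diag A D)
    IsSp-diag AᵀD≈I = ω-preserving⇒IsSp λ x y → begin
      ω (G · x) (G · y)                                                        ≡⟨ ω-coordinates (G · x) (G · y) ⟩
      dot (upper (G · x)) (lower (G · y)) - dot (lower (G · x)) (upper (G · y))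
        ≡⟨ cong₂ _-_ (dot-cong (diag-·-tp x) (diag-·-bt y)) (dot-cong (diag-·-bt x) (diag-·-tp y)) ⟩
      dot (A · upper x) (D · lower y) - dot (D · lower x) (A · upper y)
        ≡⟨ cong₂ _-_ (dot-· A (upper x) (D · lower y)) (dot-· D (lower x) (A · upper y)) ⟩
      dot (upper x) (transpose A · (D · lower y)) - dot (lower x) (transpose D · (A · upper y))
        ≡⟨ cong₂ _-_ (dot-congʳ (upper x) (·-inverse {B = transpose A} {D} AᵀD≈I (lower y)))
                     (dot-congʳ (lower x) (·-inverse {B = transpose D} {A} DᵀA≈I (upper y))) ⟩
      dot (upper x) (lower y) - dot (lower x) (upper y)                          ≡⟨ ω-coordinates x y ⟨
      ω x y                                                                    ∎
      where
      open ≡-Reasoning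
      G = diag A D
      DᵀA≈I : transpose D ⊗ A ≈M δ
      DᵀA≈I i j = trans (sumℚ-cong (λ k → QP.*-comm (D k i) (A k j))) (trans (AᵀD≈I j i) (δ-sym j i))

private
  patch : (p q r s d ia ja ib jb : ℚ) → ℚ
  patch p q r s d ia ja ib jb = d + (p - 1ℚ) * (ia * ja) + q * (ia * jb) + r * (ib * ja) + (s - 1ℚ) * (ib * jb)

  patch-col-a : ∀ p q r s x y → x + (p - 1ℚ) * (x * 1ℚ) + q * (x * 0ℚ) + r * (y * 1ℚ) + (s - 1ℚ) * (y * 0ℚ) ≡ p * x + r * y
  patch-col-a = solve-∀ ℚ-ring

  patch-col-b : ∀ p q r s x y → y + (p - 1ℚ) * (x * 0ℚ) + q * (x * 1ℚ) + r * (y * 0ℚ) + (s - 1ℚ) * (y * 1ℚ) ≡ q * x + s * y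
  patch-col-b = solve-∀ ℚ-ring

  patch-col-other : ∀ p q r s d x y → d + (p - 1ℚ) * (x * 0ℚ) + q * (x * 0ℚ) + r * (y * 0ℚ) + (s - 1ℚ) * (y * 0ℚ) ≡ d
  patch-col-other = solve-∀ ℚ-ring

  patch-transpose : ∀ p q r s d ia ja ib jb →
    d + (p - 1ℚ) * (ia * ja) + q * (ia * jb) + r * (ib * ja) + (s - 1ℚ) * (ib * jb) ≡
    d + (p - 1ℚ) * (ja * ia) + r * (ja * ib) + q * (jb * ia) + (s - 1ℚ) * (jb * ib)
  patch-transpose = solve-∀ ℚ-ring

module SL₂Embedding {n : ℕ} (a b : Fin n) (a≢b : a ≢ b) where

  -- the identity matrix with its (a, b) × (a, b) block replaced by (p q; r s)
  embed : ℚ → ℚ → ℚ → ℚ → Mat n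
  embed p q r s i j = patch p q r s (δ i j) (δ i a) (δ j a) (δ i b) (δ j b)

  data Position (i : Fin n) : Set where
    at-a      : i ≡ a → Position i
    at-b      : i ≡ b → Position i
    elsewhere : i ≢ a → i ≢ b → Position i

  position : ∀ i → Position i
  position i with i F.≟ a | i F.≟ b
  ... | yes i≡a | _       = at-a i≡a
  ... | no _    | yes i≡b = at-b i≡b
  ... | no i≢a  | no i≢b  = elsewhere i≢a i≢b

  embed-col-a : ∀ p q r s k → embed p q r s k a ≡ p * δ k a + r * δ k b
  embed-col-a p q r s k =
    trans (cong₂ (λ u v → patch p q r s (δ k a) (δ k a) u (δ k b) v) (δ-refl a) (δ-≢ a≢b))
          (patch-col-a p q r s (δ k a) (δ k b))

  embed-col-b : ∀ p q r s k → embed p q r s k b ≡ q * δ k a + s * δ k b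
  embed-col-b p q r s k =
    trans (cong₂ (λ u v → patch p q r s (δ k b) (δ k a) u (δ k b) v) (δ-≢ (a≢b ∘ sym)) (δ-refl b))
          (patch-col-b p q r s (δ k a) (δ k b))

  embed-col-other : ∀ p q r s {i} → i ≢ a → i ≢ b → ∀ k → embed p q r s k i ≡ δ k i
  embed-col-other p q r s {i} i≢a i≢b k =
    trans (cong₂ (λ u v → patch p q r s (δ k i) (δ k a) u (δ k b) v) (δ-≢ i≢a) (δ-≢ i≢b))
          (patch-col-other p q r s (δ k i) (δ k a) (δ k b))

  embed-transpose : ∀ p q r s i j → embed p q r s i j ≡ embed p r q s j i
  embed-transpose p q r s i j = trans (patch-transpose p q r s (δ i j) (δ i a) (δ j a) (δ i b) (δ j b))
                                      (cong (λ d → patch p r q s d (δ j a) (δ i a) (δ j b) (δ i b)) (δ-sym i j))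

  IsInt-embed : ∀ {p q r s} → IsInt p → IsInt q → IsInt r → IsInt s → ∀ i j → IsInt (embed p q r s i j)
  IsInt-embed p∈ℤ q∈ℤ r∈ℤ s∈ℤ i j =
    IsInt-+ (IsInt-+ (IsInt-+ (IsInt-+ (IsInt-δ i j)
      (IsInt-* (IsInt-+ p∈ℤ (IsInt-neg 1∈ℤ)) (IsInt-* (IsInt-δ i a) (IsInt-δ j a))))
      (IsInt-* q∈ℤ (IsInt-* (IsInt-δ i a) (IsInt-δ j b))))
      (IsInt-* r∈ℤ (IsInt-* (IsInt-δ i b) (IsInt-δ j a))))
      (IsInt-* (IsInt-+ s∈ℤ (IsInt-neg 1∈ℤ)) (IsInt-* (IsInt-δ i b) (IsInt-δ j b)))
    where
    1∈ℤ : IsInt 1ℚ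
    1∈ℤ = 1ℤ , refl

  module Unimodular (x y s t : ℚ) (det≡1 : s * y - x * t ≡ 1ℚ) where
    open Symplectic n
    open BlockDiagonal n

    A D : Mat n
    A = embed y (- x) (- t) s
    D = embed s t x y

    D-row-a : ∀ j → D a j ≡ s * δ j a + t * δ j b
    D-row-a j = trans (embed-transpose s t x y a j) (embed-col-a s x t y j)

    D-row-b : ∀ j → D b j ≡ x * δ j a + y * δ j b
    D-row-b j = trans (embed-transpose s t x y b j) (embed-col-b s x t y j)

    AᵀD-a : ∀ j → (transpose A ⊗ D) a j ≡ δ a j
    AᵀD-a j = begin
      sumℚ (λ k → A k a * D k j)
        ≡⟨ sumℚ-cong (λ k → cong (_* D k j) (embed-col-a y (- x) (- t) s k)) ⟩
      sumℚ (λ k → (y * δ k a + - t * δ k b) * D k j)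
        ≡⟨ sumℚ-pair y (- t) a b (λ k → D k j) ⟩
      y * D a j + - t * D b j
        ≡⟨ cong₂ (λ u v → y * u + - t * v) (D-row-a j) (D-row-b j) ⟩
      y * (s * δ j a + t * δ j b) + - t * (x * δ j a + y * δ j b)
        ≡⟨ collect-a x y s t (δ j a) (δ j b) ⟩
      (s * y - x * t) * δ j a
        ≡⟨ trans (cong (_* δ j a) det≡1) (QP.*-identityˡ (δ j a)) ⟩
      δ j a
        ≡⟨ δ-sym j a ⟩
      δ a j ∎
      where
      open ≡-Reasoning
      collect-a : ∀ x y s t p q → y * (s * p + t * q) + - t * (x * p + y * q) ≡ (s * y - x * t) * p
      collect-a = solve-∀ ℚ-ring
    AᵀD-b : ∀ j → (transpose A ⊗ D) b j ≡ δ b j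
    AᵀD-b j = begin
      sumℚ (λ k → A k b * D k j)
        ≡⟨ sumℚ-cong (λ k → cong (_* D k j) (embed-col-b y (- x) (- t) s k)) ⟩
      sumℚ (λ k → (- x * δ k a + s * δ k b) * D k j)
        ≡⟨ sumℚ-pair (- x) s a b (λ k → D k j) ⟩
      - x * D a j + s * D b j
        ≡⟨ cong₂ (λ u v → - x * u + s * v) (D-row-a j) (D-row-b j) ⟩
      - x * (s * δ j a + t * δ j b) + s * (x * δ j a + y * δ j b)
        ≡⟨ collect-b x y s t (δ j a) (δ j b) ⟩
      (s * y - x * t) * δ j b
        ≡⟨ trans (cong (_* δ j b) det≡1) (QP.*-identityˡ (δ j b)) ⟩
      δ j b
        ≡⟨ δ-sym j b ⟩
      δ b j ∎
      where
      open ≡-Reasoning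
      collect-b : ∀ x y s t p q → - x * (s * p + t * q) + s * (x * p + y * q) ≡ (s * y - x * t) * q
      collect-b = solve-∀ ℚ-ring
    AᵀD-other : ∀ {i} → i ≢ a → i ≢ b → ∀ j → (transpose A ⊗ D) i j ≡ δ i j
    AᵀD-other {i} i≢a i≢b j = begin
      sumℚ (λ k → A k i * D k j)
        ≡⟨ sumℚ-cong (λ k → cong (_* D k j) (embed-col-other y (- x) (- t) s i≢a i≢b k)) ⟩
      sumℚ (λ k → δ k i * D k j)
        ≡⟨ sumℚ-δˡ i (λ k → D k j) ⟩
      D i j
        ≡⟨ embed-transpose s t x y i j ⟩
      embed s x t y j i
        ≡⟨ embed-col-other s x t y i≢a i≢b j ⟩
      δ j i
        ≡⟨ δ-sym j i ⟩
      δ i j ∎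
      where open ≡-Reasoning

    AᵀD≈I : transpose A ⊗ D ≈M δ
    AᵀD≈I i j with position i
    ... | at-a refl           = AᵀD-a j
    ... | at-b refl           = AᵀD-b j
    ... | elsewhere i≢a i≢b = AᵀD-other i≢a i≢b j

    γ : Mat (n ℕ.+ n)
    γ = diag A D

    v : V
    v k = x * δ k (tp a) + y * δ k (tp b)

    v-tp-a : v (tp a) ≡ x
    v-tp-a = trans (cong₂ (λ p q → x * p + y * q) (δ-refl (tp a)) (trans (δ-tp-tp a b) (δ-≢ a≢b)))
                   (trans (cong₂ _+_ (QP.*-identityʳ x) (QP.*-zeroʳ y)) (QP.+-identityʳ x))

    v-tp-b : v (tp b) ≡ y
    v-tp-b = trans (cong₂ (λ p q → x * p + y * q) (trans (δ-tp-tp b a) (δ-≢ (a≢b ∘ sym))) (δ-refl (tp b)))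
                   (trans (cong₂ _+_ (QP.*-zeroʳ x) (QP.*-identityʳ y)) (QP.+-identityˡ y))

    v-bt : ∀ j → v (bt j) ≡ 0ℚ
    v-bt j = trans (cong₂ (λ p q → x * p + y * q) (δ-bt-tp j a) (δ-bt-tp j b))
                   (trans (cong₂ _+_ (QP.*-zeroʳ x) (QP.*-zeroʳ y)) (QP.+-identityˡ 0ℚ))

    γ-sends-v : ∀ k → (γ · v) k ≡ δ k (tp b)
    γ-sends-v k with half k
    ... | tp-half i = begin
      (γ · v) (tp i)
        ≡⟨ diag-·-tp A D v i ⟩
      sumℚ (λ j → A i j * v (tp j))
        ≡⟨ sumℚ-cong (λ j → trans (QP.*-comm (A i j) (v (tp j)))
                                  (cong₂ (λ u w → (x * u + y * w) * A i j) (δ-tp-tp j a) (δ-tp-tp j b))) ⟩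
      sumℚ (λ j → (x * δ j a + y * δ j b) * A i j)
        ≡⟨ sumℚ-pair x y a b (A i) ⟩
      x * A i a + y * A i b
        ≡⟨ cong₂ (λ u w → x * u + y * w) (embed-col-a y (- x) (- t) s i) (embed-col-b y (- x) (- t) s i) ⟩
      x * (y * δ i a + - t * δ i b) + y * (- x * δ i a + s * δ i b)
        ≡⟨ collect x y s t (δ i a) (δ i b) ⟩
      (s * y - x * t) * δ i b
        ≡⟨ trans (cong (_* δ i b) det≡1) (QP.*-identityˡ (δ i b)) ⟩
      δ i b
        ≡⟨ δ-tp-tp i b ⟨
      δ (tp i) (tp b) ∎
      where
      open ≡-Reasoning
      collect : ∀ x y s t p q → x * (y * p + - t * q) + y * (- x * p + s * q) ≡ (s * y - x * t) * q
      collect = solve-∀ ℚ-ring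
    ... | bt-half i = begin
      (γ · v) (bt i)
        ≡⟨ diag-·-bt A D v i ⟩
      sumℚ (λ j → D i j * v (bt j))
        ≡⟨ sumℚ-zero (λ j → trans (cong (D i j *_) (v-bt j)) (QP.*-zeroʳ (D i j))) ⟩
      0ℚ
        ≡⟨ δ-bt-tp i b ⟨
      δ (bt i) (tp b) ∎
      where open ≡-Reasoning

    γ∈Γ₀ : ∀ N → IsInt x → IsInt y → IsInt s → IsInt t → InΓ₀ n N γ
    γ∈Γ₀ N x∈ℤ y∈ℤ s∈ℤ t∈ℤ = IsSp-diag A D AᵀD≈I , integral , lower-left
      where
      integral : ∀ u w → IsInt (γ u w)
      integral u w with half u | half w
      ... | tp-half i | tp-half j =
        subst IsInt (sym (diag-tp-tp A D i j)) (IsInt-embed y∈ℤ (IsInt-neg x∈ℤ) (IsInt-neg t∈ℤ) s∈ℤ i j)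
      ... | bt-half i | bt-half j = subst IsInt (sym (diag-bt-bt A D i j)) (IsInt-embed s∈ℤ t∈ℤ x∈ℤ y∈ℤ i j)
      ... | tp-half i | bt-half j = subst IsInt (sym (diag-tp-bt A D i j)) (+ 0 , refl)
      ... | bt-half i | tp-half j = subst IsInt (sym (diag-bt-tp A D i j)) (+ 0 , refl)
      lower-left : ∀ i j → ∃ λ z → γ (bot i) (top j) ≡ ((+ N) ℤ.* z) / 1
      lower-left i j = + 0 , trans (diag-bt-tp A D i j) (cong (_/ 1) (sym (ℤP.*-zeroʳ (+ N))))

module ColumnReduction {n : ℕ} {a ℓ z : Fin n} (a≢ℓ : a ≢ ℓ) (z≢ℓ : z ≢ ℓ) (g : Mat (n ℕ.+ n)) (g-sp : IsSp n g) where
  open Symplectic n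
  open Parabolic n

  w : V
  w = col g (tp ℓ)

  open UnimodularAnnihilator (unimodularAnnihilator (w (bt a)) (w (bt ℓ)) (w (tp a)) (w (tp ℓ)))
  open SL₂Embedding a ℓ a≢ℓ
  open Unimodular (ι x) (ι y) (ι s) (ι t) det≡1

  u : V
  u = proj₁ (IsSp-surjective g-sp v)

  g·u≡v : ∀ i → (g · u) i ≡ v i
  g·u≡v = proj₂ (IsSp-surjective g-sp v)

  u-bt-ℓ≡0 : u (bt ℓ) ≡ 0ℚ
  u-bt-ℓ≡0 = begin
    u (bt ℓ)
      ≡⟨ unit-tp-ω u ℓ ⟨
    ω (unit (tp ℓ)) u
      ≡⟨ ω-· g-sp (unit (tp ℓ)) u ⟨
    ω (g · unit (tp ℓ)) (g · u)
      ≡⟨ ω-cong (·-unit g (tp ℓ)) g·u≡v ⟩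
    ω w v
      ≡⟨ ω-linearʳ w (ι x) (unit (tp a)) (ι y) (unit (tp ℓ)) (λ _ → refl) ⟩
    ι x * ω w (unit (tp a)) + ι y * ω w (unit (tp ℓ))
      ≡⟨ cong₂ (λ p q → ι x * p + ι y * q) (ω-unit-tp w a) (ω-unit-tp w ℓ) ⟩
    ι x * - w (bt a) + ι y * - w (bt ℓ)
      ≡⟨ negate (ι x) (w (bt a)) (ι y) (w (bt ℓ)) ⟩
    - (ι x * w (bt a) + ι y * w (bt ℓ))
      ≡⟨ cong -_ annihilates ⟩
    0ℚ ∎
    where
    open ≡-Reasoning
    negate : ∀ x p y q → x * - p + y * - q ≡ - (x * p + y * q)
    negate = solve-∀ ℚ-ring

  u-off-line : ∃ λ k → k ≢ tp ℓ × u k ≢ 0ℚ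
  u-off-line with FP.any? (λ k → ¬? (k F.≟ tp ℓ) ×-dec ¬? (u k QP.≟ 0ℚ))
  ... | yes found = found
  ... | no none = ⊥-elim (not-multiple c   -- u = c e_ℓ would give v = c w
                    (trans (sym v-tp-a) (v≡cw (tp a))) (trans (sym v-tp-b) (v≡cw (tp ℓ)))
                    (trans (sym (v≡cw (bt a))) (v-bt a)) (trans (sym (v≡cw (bt ℓ))) (v-bt ℓ)))
    where
    c = u (tp ℓ)
    on-line : ∀ k → Dec (k ≡ tp ℓ) → u k ≡ c * δ k (tp ℓ)
    on-line k (yes refl) = sym (trans (cong (c *_) (δ-refl (tp ℓ))) (QP.*-identityʳ c))
    on-line k (no k≢ℓ)   = trans (decidable-stable (u k QP.≟ 0ℚ) (λ uk≢0 → none (k , k≢ℓ , uk≢0)))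
                                 (sym (trans (cong (c *_) (δ-≢ k≢ℓ)) (QP.*-zeroʳ c)))
    v≡cw : ∀ i → v i ≡ c * w i
    v≡cw i = begin
      v i                                       ≡⟨ g·u≡v i ⟨
      (g · u) i                                 ≡⟨ ·-congʳ g (λ k → on-line k (k F.≟ tp ℓ)) i ⟩
      sumℚ (λ k → g i k * (c * δ k (tp ℓ)))     ≡⟨ sumℚ-cong (λ k → swap (g i k) c (δ k (tp ℓ))) ⟩
      sumℚ (λ k → c * (g i k * δ k (tp ℓ)))     ≡⟨ *-distribˡ-sumℚ c (λ k → g i k * δ k (tp ℓ)) ⟨
      c * sumℚ (λ k → g i k * δ k (tp ℓ))       ≡⟨ cong (c *_) (sumℚ-δʳ (tp ℓ) (g i)) ⟩
      c * w i                                   ∎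
      where
      open ≡-Reasoning
      swap : ∀ a c d → a * (c * d) ≡ c * (a * d)
      swap = solve-∀ ℚ-ring

  open Reachability n ℓ z z≢ℓ

  u-reachable : Reachable u
  u-reachable = let k , k≢ℓ , uk≢0 = u-off-line in reachable u u-bt-ℓ≡0 k k≢ℓ uk≢0

  p : Mat (n ℕ.+ n)
  p = proj₁ u-reachable

  p-sends : ∀ i → p i (tp z) ≡ u i
  p-sends = proj₂ (proj₂ (proj₂ u-reachable))

  γgp-sends : ∀ i → ((γ ⊗ g) ⊗ p) i (tp z) ≡ δ i (tp ℓ)
  γgp-sends i = begin
    ((γ ⊗ g) · col p (tp z)) i  ≡⟨ ·-congʳ (γ ⊗ g) p-sends i ⟩
    ((γ ⊗ g) · u) i             ≡⟨ ·-assoc γ g u i ⟩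
    (γ · (g · u)) i             ≡⟨ ·-congʳ γ g·u≡v i ⟩
    (γ · v) i                   ≡⟨ γ-sends-v i ⟩
    δ i (tp ℓ)                  ∎
    where open ≡-Reasoning

  column-reduction : ∃₂ λ γ p → (∀ N → InΓ₀ n N γ) × IsSp n p × FixesTop ℓ p ×
                                (∀ i → ((γ ⊗ g) ⊗ p) i (tp z) ≡ δ i (tp ℓ))
  column-reduction =
    let _ , p-sp , p-fixes , _ = u-reachable
    in γ , p , (λ N → γ∈Γ₀ N (IsInt-ι x) (IsInt-ι y) (IsInt-ι s) (IsInt-ι t)) , p-sp , p-fixes , γgp-sends

lemma4p5 : (n N : ℕ) → 2 ≤ n → 1 ≤ N → (g : Mat (n Data.Nat.+ n)) → IsSp n g →
    ∃ λ γ → ∃ λ p → ∃ λ q → InΓ₀ n N γ × InP n p × InP n q × ((γ ⊗ g) ⊗ p ≈M q ⊗ R n)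
-- γ has a vanishing lower-left block.
lemma4p5 n@(suc (suc m)) N (s≤s (s≤s z≤n)) _ g g-sp =
  let γ , p , γ∈Γ₀ , p-sp , p-fixes , X-sends =
        ColumnReduction.column-reduction {n} {F.zero} {ℓ} {F.zero} (λ ()) (λ ()) g g-sp
      X = (γ ⊗ g) ⊗ p
      X-sp = IsSp-⊗ {γ ⊗ g} {p} (IsSp-⊗ {γ} {g} (proj₁ (γ∈Γ₀ N)) g-sp) p-sp
  in  γ , p , X ⊗ R n , γ∈Γ₀ N
    , IsSp∧FixesTop⇒InP {ℓ} {p} ℓ-last p-sp p-fixes
    , IsSp∧FixesTop⇒InP {ℓ} {X ⊗ R n} ℓ-last (IsSp-⊗R {X} X-sp) (FixesTop-⊗R {X} {F.zero} X-sends)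
    , λ i j → sym (⊗R⊗R X i j)
  where
  open Symplectic n
  open Parabolic n
  open Reversal n
  ℓ : Fin n
  ℓ = opposite F.zero
  ℓ-last : toℕ ℓ ≡ n ℕ.∸ 1
  ℓ-last = FP.toℕ-fromℕ (suc m)
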